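{- Let $S_n(1\to n)$ be the set of $\sigma\in S_n$ in which $1$ appears to the left of $n$, and $B_n^{(1,0,1,0)}(x)=\sum_{\sigma\in S_n(1\to n)}x^{mmp^{(1,0,1,0)}(\sigma)}$. Then \[ B^{(1,0,1,0)}(t,x):=\sum_{n\ge2}B_n^{(1,0,1,0)}(x)\frac{t^{n-2}}{(n-2)!}=(1-tx)^{ -1-\frac{2}{x}}, \] and for $n\ge1$, \[ B_{2n}^{(1,0,1,0)}(x)=2^{n-1}\prod_{i=1}^{n-1}(1+ix)\prod_{i=1}^{n-1}\big(2+(2i-1)x\big), \] while for $n\ge 2$, \[ B_{2n-1}^{(1,0,1,0)}(x)=2^{n-2}\prod_{i=1}^{n-2}(1+ix)\prod_{i=1}^{n-1}\big(2+(2i-1)x\big). \]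
   Context: For $\sigma=\sigma_1\cdots\sigma_n\in S_n$, $\sigma_i$ matches $MMP(1,0,1,0)$ if there is some $j>i$ with $\sigma_j>\sigma_i$ and some $j<i$ with $\sigma_j<\sigma_i$. $mmp^{(1,0,1,0)}(\sigma)$ is the number of such $i$. -}

module Defs where

open import Data.Nat using (ℕ; zero; suc; _<ᵇ_; _≡ᵇ_; _∸_) renaming (_*_ to _*ℕ_; _+_ to _+ℕ_)
open import Data.Bool using (T?; Bool; true; false; if_then_else_; _∧_)
open import Data.List using (List; []; _∷_; _++_; [_]; map; concatMap; filter; foldr; length; upTo)
open import Data.Bool.ListAction using (any)
open import Data.List.Relation.Unary.Unique.Propositional using (Unique)
open import Data.List.Relation.Unary.Unique.DecPropositional using (unique?)
open import Data.Nat.Properties using (_≟_)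
open import Relation.Nullary.Decidable using (⌊_⌋)
open import Algebra.Bundles using (CommutativeSemiring)
open import Level using (Level)

words : ℕ → ℕ → List (List ℕ)
words zero    n = [] ∷ []
words (suc m) n = concatMap (λ v → map (v ∷_) (words m n)) (map suc (upTo n))

-- A word of length n over {1,…,n} with distinct letters, i.e. a permutation
-- σ = σ₁⋯σₙ ∈ Sₙ written in one-line notation.
isPerm : ℕ → List ℕ → Bool
isPerm n w = (length w ≡ᵇ n) ∧ ⌊ unique? _≟_ w ⌋

oneLeftOf : ℕ → List ℕ → Bool
oneLeftOf n []      = false
oneLeftOf n (a ∷ w) =
  if a ≡ᵇ 1 then any (λ b → b ≡ᵇ n) w
  else (if a ≡ᵇ n then false else oneLeftOf n w)

S1n : ℕ → List (List ℕ)
S1n n = filter (λ w → T? (isPerm n w ∧ oneLeftOf n w)) (words n n)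

mmpAux : List ℕ → List ℕ → ℕ
mmpAux pre []      = 0
mmpAux pre (a ∷ w) =
  (if any (λ b → b <ᵇ a) pre ∧ any (λ b → a <ᵇ b) w then 1 else 0)
  +ℕ mmpAux (pre ++ [ a ]) w

mmp1010 : List ℕ → ℕ
mmp1010 w = mmpAux [] w

module Poly {c ℓ : Level} (R : CommutativeSemiring c ℓ) where
  open CommutativeSemiring R using (Carrier; _+_; _*_; 0#; 1#)
  open import Algebra.Definitions.RawSemiring (CommutativeSemiring.rawSemiring R) using (_^_; _×_) public

  B : ℕ → Carrier → Carrier
  B n x = foldr (λ w acc → (x ^ mmp1010 w) + acc) 0# (S1n n)

  prod : ℕ → (ℕ → Carrier) → Carrier
  prod zero    f = 1#
  prod (suc m) f = prod m f * f (suc m)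

  two : Carrier
  two = 1# + 1#

  -- Coefficient form of the EGF identity: the coefficient of t^{m}/m! in
  -- (1-tx)^{-1-2/x} is ∏_{k=0}^{m-1} (1 + 2/x + k)·x = ∏_{k=1}^{m} (2 + k x).
  egfRHS : ℕ → Carrier → Carrier
  egfRHS m x = prod m (λ k → two + (k × x))

  -- 2^{n-1} ∏_{i=1}^{n-1}(1+ix) ∏_{i=1}^{n-1}(2+(2i-1)x), written with n = n' + 1.
  evenRHS : ℕ → Carrier → Carrier
  evenRHS n' x = (two ^ n') * (prod n' (λ i → 1# + (i × x))
                              * prod n' (λ i → two + (((2 *ℕ i) ∸ 1) × x)))

  -- 2^{n-2} ∏_{i=1}^{n-2}(1+ix) ∏_{i=1}^{n-1}(2+(2i-1)x), written with n = n' + 2.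
  oddRHS : ℕ → Carrier → Carrier
  oddRHS n' x = (two ^ n') * (prod n' (λ i → 1# + (i × x))
                             * prod (suc n') (λ i → two + (((2 *ℕ i) ∸ 1) × x)))

-- A permutation in which 1 precedes n is σ = l 1 c n r, where l c r rearranges the interior
-- letters 2, …, n−1.  Every letter of c is counted by mmp, a letter of l exactly when a smaller
-- letter lies to its left, and a letter of r exactly when a larger one lies to its right.  Building
-- the arrangements of a block by inserting its letters one at a time (in increasing order for l, so
-- that the new letter counts unless it is placed first, and in decreasing order for r, so that it
-- counts unless it is placed last) shows that the three blocks contribute ∏(1 + ix), ∏(i + 1)x and
-- ∏(1 + ix).  Distributing the interior letters one by one over the three blocks then multiplies by
-- (1 + ix) + (1 + j)x + (1 + kx) = 2 + (1 + i + j + k)x at each step, which gives the coefficient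
-- ∏_{k=1}^{n−2} (2 + kx) of the exponential generating function; the formulas for B_{2n} and
-- B_{2n−1} regroup this product.

module Submission where

open import Defs
open import Algebra.Bundles using (CommutativeSemiring)
open import Level using (Level)

module Combinatorics where

  open import Data.Nat using (ℕ; zero; suc; _+_; _<_; _>_; _≤_; _<ᵇ_; _≡ᵇ_; z≤n; s≤s)
  import Data.Nat.Properties as ℕ
  open import Data.Bool using (Bool; true; false; T; _∧_; _∨_; if_then_else_)
  import Data.Bool.Properties as Bool
  open import Data.Bool.ListAction using (any)
  open import Data.List using (List; []; _∷_; _++_; [_]; map; concatMap; length; upTo)
  import Data.List.Properties as List
  open import Data.List.Membership.Propositional using (_∈_; _∉_; find; lose)
  open import Data.List.Membership.Propositional.Properties
    using (∈-map⁺; ∈-map⁻; ∈-++⁺ˡ; ∈-++⁺ʳ; ∈-++⁻; ∈-∃++; ∈-concatMap⁺; ∈-concatMap⁻;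
           ∈-filter⁺; ∈-filter⁻; ∈-upTo⁺; ∈-upTo⁻)
  open import Data.List.Membership.Propositional.Properties.WithK using (unique∧set⇒bag)
  open import Data.List.Relation.Unary.Any using (here; there)
  open import Data.List.Relation.Unary.Any.Properties using (any⁻)
  open import Data.List.Relation.Unary.All as All using (All; []; _∷_)
  import Data.List.Relation.Unary.All.Properties as All
  open import Data.List.Relation.Unary.AllPairs as AllPairs using (AllPairs; []; _∷_)
  import Data.List.Relation.Unary.AllPairs.Properties as AllPairs
  open import Data.List.Relation.Unary.Unique.Propositional using (Unique)
  import Data.List.Relation.Unary.Unique.Propositional.Properties as Unique
  open import Data.List.Relation.Binary.Disjoint.Propositional using (Disjoint)
  open import Data.List.Relation.Binary.Permutation.Propositional using (_↭_; ↭-refl; ↭-prep; ↭-sym; ↭-trans; ↭⇒↭ₛ)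
  open import Data.List.Relation.Binary.Permutation.Propositional.Properties
    using (↭-empty-inv; ∈-resp-↭; All-resp-↭; ↭-length; shift; drop-mid; drop-∷; ++⁺; ++⁺ˡ; ∷↭∷ʳ)
  import Data.List.Relation.Binary.Permutation.Setoid.Properties as Permutationₛ
  open import Data.List.Relation.Binary.BagAndSetEquality using (∼bag⇒↭)
  open import Data.Product using (_×_; _,_; proj₁; proj₂; ∃; ∃₂)
  open import Data.Sum using (inj₁; inj₂)
  open import Data.Empty using (⊥-elim)
  open import Function.Bundles using (_⇔_; mk⇔; Equivalence)
  open import Function.Base using (flip; _∘_)
  open import Relation.Nullary using (yes; no)
  open import Relation.Nullary.Decidable using (T?; toWitness; fromWitness)
  open import Relation.Binary.Definitions using (DecidableEquality)
  import Data.List.Membership.DecPropositional as Membership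
  open import Data.List.Membership.DecPropositional ℕ._≟_ using (_∈?_)
  open import Relation.Binary.PropositionalEquality
    using (_≡_; _≢_; refl; sym; trans; cong; subst; setoid)

  module _ {A B : Set} where

    Unique-concatMap⁺ : (g : A → List B) {xs : List A} → Unique xs →
                        (∀ {a} → a ∈ xs → Unique (g a)) →
                        (∀ {a b z} → a ∈ xs → b ∈ xs → z ∈ g a → z ∈ g b → a ≡ b) →
                        Unique (concatMap g xs)
    Unique-concatMap⁺ g {[]} _ _ _ = []
    Unique-concatMap⁺ g {a ∷ xs} (a∉xs ∷ !xs) !g fibres =
      Unique.++⁺ (!g (here refl))
                 (Unique-concatMap⁺ g !xs (λ p → !g (there p)) (λ p q → fibres (there p) (there q)))
                 disjoint
      where
      disjoint : Disjoint (g a) (concatMap g xs)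
      disjoint (z∈ga , z∈rest) with find (∈-concatMap⁻ g {xs = xs} z∈rest)
      ... | b , b∈xs , z∈gb = All.lookup a∉xs b∈xs (fibres (here refl) (there b∈xs) z∈ga z∈gb)

  module _ {A : Set} where

    Unique-++⁻ : (xs : List A) {ys : List A} → Unique (xs ++ ys) →
                 Unique xs × Unique ys × Disjoint xs ys
    Unique-++⁻ [] !ys = [] , !ys , λ ()
    Unique-++⁻ (x ∷ xs) (x∉ ∷ !) with Unique-++⁻ xs ! | All.++⁻ xs x∉
    ... | !xs , !ys , xs#ys | x∉xs , x∉ys = (x∉xs ∷ !xs) , !ys , disjoint
      where
      disjoint : Disjoint (x ∷ xs) _
      disjoint (here refl , z∈ys) = All.lookup x∉ys z∈ys refl
      disjoint (there z∈xs , z∈ys) = xs#ys (z∈xs , z∈ys)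

    Unique-resp-↭ : {xs ys : List A} → xs ↭ ys → Unique xs → Unique ys
    Unique-resp-↭ p = Permutationₛ.Unique-resp-↭ (setoid A) (↭⇒↭ₛ p)

    record UniqueBlocks (xs ys zs : List A) : Set where
      field
        !₁ : Unique xs
        !₂ : Unique ys
        !₃ : Unique zs
        #₁₂ : ∀ {z} → z ∈ xs → z ∉ ys
        #₁₃ : ∀ {z} → z ∈ xs → z ∉ zs
        #₂₃ : ∀ {z} → z ∈ ys → z ∉ zs

    ↭-UniqueBlocks : ∀ {xs ys zs O} → Unique O → xs ++ ys ++ zs ↭ O → UniqueBlocks xs ys zs
    ↭-UniqueBlocks {xs = xs} {ys} !O ↭O with Unique-++⁻ xs (Unique-resp-↭ (↭-sym ↭O) !O)
    ... | !xs , !yszs , xs#yszs with Unique-++⁻ ys !yszs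
    ... | !ys , !zs , ys#zs = record
      { !₁ = !xs ; !₂ = !ys ; !₃ = !zs
      ; #₁₂ = λ z∈xs z∈ys → xs#yszs (z∈xs , ∈-++⁺ˡ z∈ys)
      ; #₁₃ = λ z∈xs z∈zs → xs#yszs (z∈xs , ∈-++⁺ʳ ys z∈zs)
      ; #₂₃ = λ z∈ys z∈zs → ys#zs (z∈ys , z∈zs)
      }

    unique∧set⇒↭ : {xs ys : List A} → Unique xs → Unique ys →
                   (∀ {z} → z ∈ xs ⇔ z ∈ ys) → xs ↭ ys
    unique∧set⇒↭ !xs !ys xs≈ys = ∼bag⇒↭ (unique∧set⇒bag !xs !ys xs≈ys)

    ++-∷-cancel : ∀ {e : A} xs xs′ {ys ys′} → e ∉ xs → e ∉ xs′ →
                  xs ++ e ∷ ys ≡ xs′ ++ e ∷ ys′ → xs ≡ xs′ × ys ≡ ys′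
    ++-∷-cancel [] [] _ _ refl = refl , refl
    ++-∷-cancel [] (b ∷ xs′) _ e∉ refl = ⊥-elim (e∉ (here refl))
    ++-∷-cancel (a ∷ xs) [] e∉ _ refl = ⊥-elim (e∉ (here refl))
    ++-∷-cancel (a ∷ xs) (b ∷ xs′) e∉ e∉′ eq with List.∷-injective eq
    ... | refl , eq′ with ++-∷-cancel xs xs′ (λ p → e∉ (there p)) (λ p → e∉′ (there p)) eq′
    ... | refl , refl = refl , refl

    private
      ∈-remove : ∀ {y z : A} ys₁ {ys₂} → y ∈ ys₁ ++ z ∷ ys₂ → z ≢ y → y ∈ ys₁ ++ ys₂
      ∈-remove ys₁ {ys₂} y∈ z≢y with ∈-resp-↭ (shift _ ys₁ ys₂) y∈
      ... | here refl = ⊥-elim (z≢y refl)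
      ... | there y∈′ = y∈′

      length-remove : ∀ (z : A) ys₁ ys₂ → length (ys₁ ++ z ∷ ys₂) ≡ suc (length (ys₁ ++ ys₂))
      length-remove z ys₁ ys₂ = ↭-length (shift z ys₁ ys₂)

    Unique-⊆⇒length≤ : {xs ys : List A} → Unique xs → (∀ {z} → z ∈ xs → z ∈ ys) →
                       length xs ≤ length ys
    Unique-⊆⇒length≤ {[]} _ _ = z≤n
    Unique-⊆⇒length≤ {a ∷ xs} (a∉xs ∷ !xs) xs⊆ys with ∈-∃++ (xs⊆ys (here refl))
    ... | ys₁ , ys₂ , refl =
      subst (suc (length xs) ≤_) (sym (length-remove a ys₁ ys₂))
        (s≤s (Unique-⊆⇒length≤ !xs (λ z∈xs → ∈-remove ys₁ (xs⊆ys (there z∈xs)) (All.lookup a∉xs z∈xs))))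

    Unique-⊆-length≥⇒⊇ : DecidableEquality A → {xs ys : List A} → Unique xs → (∀ {z} → z ∈ xs → z ∈ ys) →
                          length ys ≤ length xs → ∀ {z} → z ∈ ys → z ∈ xs
    Unique-⊆-length≥⇒⊇ _≟_ {xs} !xs xs⊆ys |ys|≤|xs| {z} z∈ys with Membership._∈?_ _≟_ z xs
    ... | yes z∈xs = z∈xs
    ... | no z∉xs with ∈-∃++ z∈ys
    ... | ys₁ , ys₂ , refl = ⊥-elim (ℕ.<⇒≱ |xs|<|ys| |ys|≤|xs|)
      where
      |xs|<|ys| : length xs < length (ys₁ ++ z ∷ ys₂)
      |xs|<|ys| = subst (length xs <_) (sym (length-remove z ys₁ ys₂))
        (s≤s (Unique-⊆⇒length≤ !xs (λ y∈xs → ∈-remove ys₁ (xs⊆ys y∈xs) (λ { refl → z∉xs y∈xs }))))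

    -- Permutations and tripartitions of a list

    insertions : A → List A → List (List A)
    insertions e []       = [ [ e ] ]
    insertions e (y ∷ ys) = (e ∷ y ∷ ys) ∷ map (y ∷_) (insertions e ys)

    permutations : List A → List (List A)
    permutations []      = [ [] ]
    permutations (e ∷ xs) = concatMap (insertions e) (permutations xs)

    ∈-insertions⁺ : ∀ e xs ys → xs ++ e ∷ ys ∈ insertions e (xs ++ ys)
    ∈-insertions⁺ e [] [] = here refl
    ∈-insertions⁺ e [] (y ∷ ys) = here refl
    ∈-insertions⁺ e (x ∷ xs) ys = there (∈-map⁺ (x ∷_) (∈-insertions⁺ e xs ys))

    ∈-insertions⁻ : ∀ {e w} u → w ∈ insertions e u → ∃₂ λ xs ys → u ≡ xs ++ ys × w ≡ xs ++ e ∷ ys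
    ∈-insertions⁻ [] (here refl) = [] , [] , refl , refl
    ∈-insertions⁻ (y ∷ ys) (here refl) = [] , y ∷ ys , refl , refl
    ∈-insertions⁻ (y ∷ ys) (there w∈) with ∈-map⁻ (y ∷_) w∈
    ... | v , v∈ , refl with ∈-insertions⁻ ys v∈
    ... | xs , zs , refl , refl = y ∷ xs , zs , refl , refl

    ∈-insertions⇒↭ : ∀ {e w} u → w ∈ insertions e u → w ↭ e ∷ u
    ∈-insertions⇒↭ {e} u w∈ with ∈-insertions⁻ u w∈
    ... | xs , ys , refl , refl = shift e xs ys

    insertions-length : ∀ e u → length (insertions e u) ≡ suc (length u)
    insertions-length e [] = refl
    insertions-length e (y ∷ ys) = cong suc (trans (List.length-map (y ∷_) (insertions e ys)) (insertions-length e ys))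

    insertions-unique : ∀ {e} u → e ∉ u → Unique (insertions e u)
    insertions-unique [] _ = [] ∷ []
    insertions-unique {e} (y ∷ ys) e∉ =
      All.tabulate head≢ ∷ Unique.map⁺ List.∷-injectiveʳ (insertions-unique ys (λ p → e∉ (there p)))
      where
      head≢ : ∀ {w} → w ∈ map (y ∷_) (insertions e ys) → e ∷ y ∷ ys ≢ w
      head≢ w∈ eq with ∈-map⁻ (y ∷_) w∈
      ... | v , v∈ , refl with List.∷-injective eq
      ... | refl , _ = e∉ (here refl)

    ∈-permutations⁻ : ∀ {w} xs → w ∈ permutations xs → w ↭ xs
    ∈-permutations⁻ [] (here refl) = ↭-refl
    ∈-permutations⁻ (e ∷ xs) w∈ with find (∈-concatMap⁻ (insertions e) {xs = permutations xs} w∈)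
    ... | u , u∈ , w∈′ = ↭-trans (∈-insertions⇒↭ u w∈′) (↭-prep e (∈-permutations⁻ xs u∈))

    ∈-permutations⁺ : ∀ {w} xs → w ↭ xs → w ∈ permutations xs
    ∈-permutations⁺ [] w↭ rewrite ↭-empty-inv w↭ = here refl
    ∈-permutations⁺ {w} (e ∷ xs) w↭ with ∈-∃++ (∈-resp-↭ (↭-sym w↭) (here refl))
    ... | ws₁ , ws₂ , refl =
      ∈-concatMap⁺ (insertions e) {xs = permutations xs}
        (lose (∈-permutations⁺ xs (drop-mid ws₁ [] w↭)) (∈-insertions⁺ e ws₁ ws₂))

    permutations-unique : ∀ {xs} → Unique xs → Unique (permutations xs)
    permutations-unique {[]} _ = [] ∷ []
    permutations-unique {e ∷ xs} (e∉xs ∷ !xs) =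
      Unique-concatMap⁺ (insertions e) (permutations-unique !xs) (λ u∈ → insertions-unique _ (e∉ u∈)) fibres
      where
      e∉ : ∀ {u} → u ∈ permutations xs → e ∉ u
      e∉ u∈ e∈u = All.lookup e∉xs (∈-resp-↭ (∈-permutations⁻ xs u∈) e∈u) refl
      fibres : ∀ {u v w} → u ∈ permutations xs → v ∈ permutations xs →
               w ∈ insertions e u → w ∈ insertions e v → u ≡ v
      fibres {u} {v} u∈ v∈ w∈u w∈v with ∈-insertions⁻ u w∈u | ∈-insertions⁻ v w∈v
      ... | xs₁ , ys₁ , refl , refl | xs₂ , ys₂ , refl , eq
        with ++-∷-cancel xs₁ xs₂ (λ p → e∉ u∈ (∈-++⁺ˡ p)) (λ p → e∉ v∈ (∈-++⁺ˡ p)) eq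
      ... | refl , refl = refl

    Tripartition : Set
    Tripartition = List A × List A × List A

    -- The letter goes to the front of the first two blocks but to the end of the third, so that
    -- the blocks of a decreasing list come out decreasing, decreasing and increasing.
    extend : A → Tripartition → List Tripartition
    extend e (xs , ys , zs) = (e ∷ xs , ys , zs) ∷ (xs , e ∷ ys , zs) ∷ (xs , ys , zs ++ [ e ]) ∷ []

    tripartitions : List A → List Tripartition
    tripartitions []      = [ [] , [] , [] ]
    tripartitions (e ∷ O) = concatMap (extend e) (tripartitions O)

    ∈-tripartitions-∷ : ∀ {e O t} → t ∈ tripartitions (e ∷ O) → ∃ λ s → s ∈ tripartitions O × t ∈ extend e s
    ∈-tripartitions-∷ {e} {O} t∈ = find (∈-concatMap⁻ (extend e) {xs = tripartitions O} t∈)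

    ∈-tripartitions⇒↭ : ∀ {xs ys zs} O → (xs , ys , zs) ∈ tripartitions O → xs ++ ys ++ zs ↭ O
    ∈-tripartitions⇒↭ [] (here refl) = ↭-refl
    ∈-tripartitions⇒↭ (e ∷ O) t∈ with ∈-tripartitions-∷ {e} {O} t∈
    ... | (xs , ys , zs) , s∈ , here refl = ↭-prep e (∈-tripartitions⇒↭ O s∈)
    ... | (xs , ys , zs) , s∈ , there (here refl) =
      ↭-trans (shift e xs (ys ++ zs)) (↭-prep e (∈-tripartitions⇒↭ O s∈))
    ... | (xs , ys , zs) , s∈ , there (there (here refl)) =
      ↭-trans (++⁺ˡ xs (++⁺ˡ ys (↭-sym (∷↭∷ʳ e zs))))
        (↭-trans (++⁺ˡ xs (shift e ys zs))
        (↭-trans (shift e xs (ys ++ zs)) (↭-prep e (∈-tripartitions⇒↭ O s∈))))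

    All-tripartition : ∀ {P : A → Set} {xs ys zs} O → All P O → (xs , ys , zs) ∈ tripartitions O →
                       All P xs × All P ys × All P zs
    All-tripartition {xs = xs} {ys} O allO t∈ with All.++⁻ xs (All-resp-↭ (↭-sym (∈-tripartitions⇒↭ O t∈)) allO)
    ... | allXs , allYsZs with All.++⁻ ys allYsZs
    ... | allYs , allZs = allXs , allYs , allZs

    ∈-tripartitions⇒UniqueBlocks : ∀ {xs ys zs} O → Unique O → (xs , ys , zs) ∈ tripartitions O → UniqueBlocks xs ys zs
    ∈-tripartitions⇒UniqueBlocks O !O t∈ = ↭-UniqueBlocks !O (∈-tripartitions⇒↭ O t∈)

    tripartitions-sorted : ∀ {R : A → A → Set} {xs ys zs} O → AllPairs R O →
                           (xs , ys , zs) ∈ tripartitions O → AllPairs R xs × AllPairs (flip R) zs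
    tripartitions-sorted [] _ (here refl) = [] , []
    tripartitions-sorted (e ∷ O) (e≺O ∷ sortedO) t∈ with ∈-tripartitions-∷ {e} {O} t∈
    ... | (xs , ys , zs) , s∈ , here refl =
      (proj₁ (All-tripartition O e≺O s∈) ∷ proj₁ (tripartitions-sorted O sortedO s∈)) ,
      proj₂ (tripartitions-sorted O sortedO s∈)
    ... | s , s∈ , there (here refl) = tripartitions-sorted O sortedO s∈
    ... | (xs , ys , zs) , s∈ , there (there (here refl)) =
      proj₁ (tripartitions-sorted O sortedO s∈) ,
      AllPairs.++⁺ (proj₂ (tripartitions-sorted O sortedO s∈)) ([] ∷ [])
                   (All.map (_∷ []) (proj₂ (proj₂ (All-tripartition O e≺O s∈))))

    tripartitions-unique : ∀ {O} → Unique O → Unique (tripartitions O)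
    tripartitions-unique {[]} _ = [] ∷ []
    tripartitions-unique {e ∷ O} (e∉O ∷ !O) =
      Unique-concatMap⁺ (extend e) (tripartitions-unique !O) (λ _ → extend-unique) fibres
      where
      e∉ : ∀ {xs ys zs} → (xs , ys , zs) ∈ tripartitions O → e ∉ xs × e ∉ ys × e ∉ zs
      e∉ s∈ with All-tripartition O e∉O s∈
      ... | e∉xs , e∉ys , e∉zs = (λ p → All.lookup e∉xs p refl) , (λ p → All.lookup e∉ys p refl) , (λ p → All.lookup e∉zs p refl)
      ∷≢ : ∀ {xs} → e ∷ xs ≢ xs
      ∷≢ eq = ℕ.1+n≢n (cong length eq)
      extend-unique : ∀ {s} → Unique (extend e s)
      extend-unique = ((λ eq → ∷≢ (cong proj₁ eq)) ∷ (λ eq → ∷≢ (cong proj₁ eq)) ∷ [])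
                    ∷ ((λ eq → ∷≢ (cong (proj₁ ∘ proj₂) eq)) ∷ [])
                    ∷ [] ∷ []
      fibres : ∀ {s s′ t} → s ∈ tripartitions O → s′ ∈ tripartitions O → t ∈ extend e s → t ∈ extend e s′ → s ≡ s′
      fibres _ _ (here refl) (here refl) = refl
      fibres _ _ (there (here refl)) (there (here refl)) = refl
      fibres {xs , ys , zs} {xs′ , ys′ , zs′} _ _ (there (there (here refl))) (there (there (here eq)))
        with cong proj₁ eq | cong (proj₁ ∘ proj₂) eq | List.∷ʳ-injectiveˡ zs zs′ (cong (proj₂ ∘ proj₂) eq)
      ... | refl | refl | refl = refl
      fibres _ s′∈ (here refl) (there (here refl)) = ⊥-elim (proj₁ (e∉ s′∈) (here refl))
      fibres _ s′∈ (here refl) (there (there (here refl))) = ⊥-elim (proj₁ (e∉ s′∈) (here refl))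
      fibres s∈ _ (there (here refl)) (here refl) = ⊥-elim (proj₁ (e∉ s∈) (here refl))
      fibres _ s′∈ (there (here refl)) (there (there (here refl))) = ⊥-elim (proj₁ (proj₂ (e∉ s′∈)) (here refl))
      fibres s∈ _ (there (there (here refl))) (here refl) = ⊥-elim (proj₁ (e∉ s∈) (here refl))
      fibres s∈ _ (there (there (here refl))) (there (here refl)) = ⊥-elim (proj₁ (proj₂ (e∉ s∈)) (here refl))

  -- The statistic on l 1 c n r

  ≡ᵇ-refl : ∀ m → (m ≡ᵇ m) ≡ true
  ≡ᵇ-refl m = Equivalence.to Bool.T-≡ (ℕ.≡⇒≡ᵇ m m refl)

  ≢⇒≡ᵇ-false : ∀ {m n} → m ≢ n → (m ≡ᵇ n) ≡ false
  ≢⇒≡ᵇ-false {m} {n} m≢n with m ≡ᵇ n in eq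
  ... | false = refl
  ... | true = ⊥-elim (m≢n (ℕ.≡ᵇ⇒≡ m n (Equivalence.from Bool.T-≡ eq)))

  <⇒<ᵇ-true : ∀ {m n} → m < n → (m <ᵇ n) ≡ true
  <⇒<ᵇ-true m<n = Equivalence.to Bool.T-≡ (ℕ.<⇒<ᵇ m<n)

  ≥⇒<ᵇ-false : ∀ {m n} → n ≤ m → (m <ᵇ n) ≡ false
  ≥⇒<ᵇ-false {m} {n} n≤m with m <ᵇ n in eq
  ... | false = refl
  ... | true = ⊥-elim (ℕ.<⇒≱ (ℕ.<ᵇ⇒< m n (Equivalence.from Bool.T-≡ eq)) n≤m)

  any-++ : ∀ (p : ℕ → Bool) xs ys → any p (xs ++ ys) ≡ (any p xs ∨ any p ys)
  any-++ p [] ys = refl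
  any-++ p (x ∷ xs) ys rewrite any-++ p xs ys = sym (Bool.∨-assoc (p x) (any p xs) (any p ys))

  ∈⇒any-true : ∀ (p : ℕ → Bool) {z xs} → z ∈ xs → p z ≡ true → any p xs ≡ true
  ∈⇒any-true p {xs = x ∷ xs} (here refl) pz rewrite pz = refl
  ∈⇒any-true p {xs = x ∷ xs} (there z∈xs) pz rewrite ∈⇒any-true p z∈xs pz = Bool.∨-zeroʳ (p x)

  All⇒any-false : ∀ (p : ℕ → Bool) {xs} → All (λ z → p z ≡ false) xs → any p xs ≡ false
  All⇒any-false p [] = refl
  All⇒any-false p (pz ∷ ps) rewrite pz | All⇒any-false p ps = refl

  nonLtrMinima : List ℕ → List ℕ → ℕ
  nonLtrMinima pre []      = 0
  nonLtrMinima pre (a ∷ w) = (if any (_<ᵇ a) pre then 1 else 0) + nonLtrMinima (pre ++ [ a ]) w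

  nonRtlMaxima : List ℕ → ℕ
  nonRtlMaxima []      = 0
  nonRtlMaxima (a ∷ w) = (if any (a <ᵇ_) w then 1 else 0) + nonRtlMaxima w

  Interior : ℕ → ℕ → Set
  Interior n a = 1 < a × a < n

  ↭Interior⇒1∉ : ∀ {n X l} → All (Interior n) X → l ↭ X → 1 ∉ l
  ↭Interior⇒1∉ X-int l↭X 1∈l = ℕ.<-irrefl refl (proj₁ (All.lookup X-int (∈-resp-↭ l↭X 1∈l)))

  ↭Interior⇒n∉ : ∀ {n X c} → All (Interior n) X → c ↭ X → n ∉ c
  ↭Interior⇒n∉ X-int c↭X n∈c = ℕ.<-irrefl refl (proj₂ (All.lookup X-int (∈-resp-↭ c↭X n∈c)))

  glue : ℕ → List ℕ → List ℕ → List ℕ → List ℕ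
  glue n l c r = l ++ 1 ∷ c ++ n ∷ r

  mmpAux-before-max : ∀ {n} pre l rest → All (_< n) l → n ∈ rest →
                      mmpAux pre (l ++ rest) ≡ nonLtrMinima pre l + mmpAux (pre ++ l) rest
  mmpAux-before-max pre [] rest _ _ rewrite List.++-identityʳ pre = refl
  mmpAux-before-max pre (a ∷ l) rest (a<n ∷ l<n) n∈rest
    rewrite ∈⇒any-true (a <ᵇ_) (∈-++⁺ʳ l n∈rest) (<⇒<ᵇ-true a<n)
          | Bool.∧-identityʳ (any (_<ᵇ a) pre)
          | mmpAux-before-max (pre ++ [ a ]) l rest l<n n∈rest
          | List.++-assoc pre [ a ] l
    = sym (ℕ.+-assoc (if any (_<ᵇ a) pre then 1 else 0) (nonLtrMinima (pre ++ [ a ]) l) _)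

  mmpAux-one : ∀ pre w → All (0 <_) pre → mmpAux pre (1 ∷ w) ≡ mmpAux (pre ++ [ 1 ]) w
  mmpAux-one pre w pre>0 rewrite All⇒any-false (_<ᵇ 1) (All.map ≥⇒<ᵇ-false pre>0) = refl

  mmpAux-between : ∀ {n} pre c rest → 1 ∈ pre → All (Interior n) c → n ∈ rest →
                   mmpAux pre (c ++ rest) ≡ length c + mmpAux (pre ++ c) rest
  mmpAux-between pre [] rest _ _ _ rewrite List.++-identityʳ pre = refl
  mmpAux-between pre (a ∷ c) rest 1∈pre ((1<a , a<n) ∷ c-interior) n∈rest
    rewrite ∈⇒any-true (a <ᵇ_) (∈-++⁺ʳ c n∈rest) (<⇒<ᵇ-true a<n)
          | ∈⇒any-true (_<ᵇ a) 1∈pre (<⇒<ᵇ-true 1<a)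
          | mmpAux-between (pre ++ [ a ]) c rest (∈-++⁺ˡ 1∈pre) c-interior n∈rest
          | List.++-assoc pre [ a ] c
    = refl

  mmpAux-max : ∀ {n} pre r → All (_< n) r → mmpAux pre (n ∷ r) ≡ mmpAux (pre ++ [ n ]) r
  mmpAux-max {n} pre r r<n
    rewrite All⇒any-false (n <ᵇ_) (All.map (λ a<n → ≥⇒<ᵇ-false (ℕ.<⇒≤ a<n)) r<n)
          | Bool.∧-zeroʳ (any (_<ᵇ n) pre) = refl

  mmpAux-after-one : ∀ pre r → 1 ∈ pre → All (1 <_) r → mmpAux pre r ≡ nonRtlMaxima r
  mmpAux-after-one pre [] _ _ = refl
  mmpAux-after-one pre (a ∷ r) 1∈pre (1<a ∷ 1<r)
    rewrite ∈⇒any-true (_<ᵇ a) 1∈pre (<⇒<ᵇ-true 1<a)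
          | mmpAux-after-one (pre ++ [ a ]) r (∈-++⁺ˡ 1∈pre) 1<r = refl

  -- Inside l only smaller letters to the left matter (n is to the right), inside c every letter
  -- counts, and inside r only larger letters to the right matter (1 is to the left).
  mmp-glue : ∀ n l c r → All (Interior n) l → All (Interior n) c → All (Interior n) r →
             mmp1010 (glue n l c r) ≡ nonLtrMinima [] l + (length c + nonRtlMaxima r)
  mmp-glue n l c r l-int c-int r-int
    rewrite mmpAux-before-max [] l (1 ∷ c ++ n ∷ r) (All.map proj₂ l-int) (there (∈-++⁺ʳ c (here refl)))
          | mmpAux-one l (c ++ n ∷ r) (All.map (λ int → ℕ.<-trans (s≤s z≤n) (proj₁ int)) l-int)
          | mmpAux-between (l ++ [ 1 ]) c (n ∷ r) (∈-++⁺ʳ l (here refl)) c-int (here refl)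
          | mmpAux-max ((l ++ [ 1 ]) ++ c) r (All.map proj₂ r-int)
          | mmpAux-after-one (((l ++ [ 1 ]) ++ c) ++ [ n ]) r
              (∈-++⁺ˡ (∈-++⁺ˡ (∈-++⁺ʳ l (here refl)))) (All.map proj₁ r-int)
    = refl

  nonLtrMinima-drop-larger : ∀ {e} pre pre′ w → All (_< e) w →
                             nonLtrMinima (pre ++ e ∷ pre′) w ≡ nonLtrMinima (pre ++ pre′) w
  nonLtrMinima-drop-larger pre pre′ [] _ = refl
  nonLtrMinima-drop-larger {e} pre pre′ (a ∷ w) (a<e ∷ w<e)
    rewrite any-++ (_<ᵇ a) pre (e ∷ pre′) | any-++ (_<ᵇ a) pre pre′
          | ≥⇒<ᵇ-false {e} {a} (ℕ.<⇒≤ a<e)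
          | List.++-assoc pre (e ∷ pre′) [ a ] | List.++-assoc pre pre′ [ a ]
          | nonLtrMinima-drop-larger pre (pre′ ++ [ a ]) w w<e = refl

  any-insertions : ∀ (p : ℕ → Bool) {e v} ys → v ∈ insertions e ys → p e ≡ false → any p v ≡ any p ys
  any-insertions p {e} ys v∈ pe≡false with ∈-insertions⁻ ys v∈
  ... | xs , zs , refl , refl rewrite any-++ p xs (e ∷ zs) | any-++ p xs zs | pe≡false = refl

  -- S₁ₙ(1→n) as the gluings of tripartitions of the interior letters

  Classifies : List ℕ → List ℕ → Tripartition → Set
  Classifies l c (A , B , C) =
    All (_∈ l) A × All (λ z → z ∉ l × z ∈ c) B × All (λ z → z ∉ l × z ∉ c) C

  place : List ℕ → List ℕ → ℕ → Tripartition → Tripartition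
  place l c e (A , B , C) with e ∈? l | e ∈? c
  ... | yes _ | _     = e ∷ A , B , C
  ... | no _  | yes _ = A , e ∷ B , C
  ... | no _  | no _  = A , B , C ++ [ e ]

  classify : List ℕ → List ℕ → List ℕ → Tripartition
  classify l c []      = [] , [] , []
  classify l c (e ∷ O) = place l c e (classify l c O)

  classify-∈ : ∀ l c O → classify l c O ∈ tripartitions O
  classify-∈ l c [] = here refl
  classify-∈ l c (e ∷ O) =
    ∈-concatMap⁺ (extend e) {xs = tripartitions O} (lose (classify-∈ l c O) (place-∈ (classify l c O)))
    where
    place-∈ : ∀ t → place l c e t ∈ extend e t
    place-∈ (A , B , C) with e ∈? l | e ∈? c
    ... | yes _ | _     = here refl
    ... | no _  | yes _ = there (here refl)
    ... | no _  | no _  = there (there (here refl))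

  classify-classifies : ∀ l c O → Classifies l c (classify l c O)
  classify-classifies l c [] = [] , [] , []
  classify-classifies l c (e ∷ O) = place-classifies (classify l c O) (classify-classifies l c O)
    where
    place-classifies : ∀ t → Classifies l c t → Classifies l c (place l c e t)
    place-classifies (A , B , C) (inA , inB , inC) with e ∈? l | e ∈? c
    ... | yes e∈l | _     = (e∈l ∷ inA) , inB , inC
    ... | no e∉l  | yes e∈c = inA , ((e∉l , e∈c) ∷ inB) , inC
    ... | no e∉l  | no e∉c  = inA , inB , All.++⁺ inC ((e∉l , e∉c) ∷ [])

  classifies⇒≡classify : ∀ {l c t} O → t ∈ tripartitions O → Classifies l c t → t ≡ classify l c O
  classifies⇒≡classify [] (here refl) _ = refl
  classifies⇒≡classify {l} {c} (e ∷ O) t∈ cl with ∈-tripartitions-∷ {e = e} {O = O} t∈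
  ... | (A , B , C) , s∈ , here refl with cl
  ...   | e∈l ∷ inA , inB , inC
    rewrite sym (classifies⇒≡classify O s∈ (inA , inB , inC)) with e ∈? l
  ...     | yes _ = refl
  ...     | no e∉l = ⊥-elim (e∉l e∈l)
  classifies⇒≡classify {l} {c} (e ∷ O) t∈ cl
    | (A , B , C) , s∈ , there (here refl) with cl
  ...   | inA , (e∉l , e∈c) ∷ inB , inC
    rewrite sym (classifies⇒≡classify O s∈ (inA , inB , inC)) with e ∈? l | e ∈? c
  ...     | yes e∈l | _      = ⊥-elim (e∉l e∈l)
  ...     | no _    | yes _  = refl
  ...     | no _    | no e∉c = ⊥-elim (e∉c e∈c)
  classifies⇒≡classify {l} {c} (e ∷ O) t∈ cl
    | (A , B , C) , s∈ , there (there (here refl)) with cl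
  ...   | inA , inB , inC′ with All.++⁻ C inC′
  ...     | inC , (e∉l , e∉c) ∷ []
    rewrite sym (classifies⇒≡classify O s∈ (inA , inB , inC)) with e ∈? l | e ∈? c
  ...       | yes e∈l | _      = ⊥-elim (e∉l e∈l)
  ...       | no _    | yes e∈c = ⊥-elim (e∉c e∈c)
  ...       | no _    | no _   = refl

  ∈-classified : ∀ {l c A B C z} O → (A , B , C) ∈ tripartitions O → Classifies l c (A , B , C) → z ∈ O →
                 (z ∈ l → z ∈ A) × (z ∉ l → z ∈ c → z ∈ B) × (z ∉ l → z ∉ c → z ∈ C)
  ∈-classified {A = A} {B} {C} O t∈ (inA , inB , inC) z∈O
    with ∈-++⁻ A (∈-resp-↭ (↭-sym (∈-tripartitions⇒↭ O t∈)) z∈O)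
  ... | inj₁ z∈A = (λ _ → z∈A) , (λ z∉l _ → ⊥-elim (z∉l (All.lookup inA z∈A)))
                              , (λ z∉l _ → ⊥-elim (z∉l (All.lookup inA z∈A)))
  ... | inj₂ z∈BC with ∈-++⁻ B z∈BC
  ...   | inj₁ z∈B = (λ z∈l → ⊥-elim (proj₁ (All.lookup inB z∈B) z∈l)) , (λ _ _ → z∈B)
                   , (λ _ z∉c → ⊥-elim (z∉c (proj₂ (All.lookup inB z∈B))))
  ...   | inj₂ z∈C = (λ z∈l → ⊥-elim (proj₁ (All.lookup inC z∈C) z∈l))
                   , (λ _ z∈c → ⊥-elim (proj₂ (All.lookup inC z∈C) z∈c)) , (λ _ _ → z∈C)

  module _ {O : List ℕ} (!O : Unique O) where

    ↭-classifies : ∀ {l c A B C} → (A , B , C) ∈ tripartitions O → l ↭ A → c ↭ B → Classifies l c (A , B , C)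
    ↭-classifies {A = A} {B} {C} t∈ l↭A c↭B =
      All.tabulate (∈-resp-↭ (↭-sym l↭A)) ,
      All.tabulate (λ z∈B → (λ z∈l → A#B (∈-resp-↭ l↭A z∈l) z∈B) , ∈-resp-↭ (↭-sym c↭B) z∈B) ,
      All.tabulate (λ z∈C → (λ z∈l → A#C (∈-resp-↭ l↭A z∈l) z∈C) , (λ z∈c → B#C (∈-resp-↭ c↭B z∈c) z∈C))
      where open UniqueBlocks (∈-tripartitions⇒UniqueBlocks O !O t∈) renaming (#₁₂ to A#B; #₁₃ to A#C; #₂₃ to B#C)

    classifies-↭ : ∀ {l c r A B C} → (A , B , C) ∈ tripartitions O → Classifies l c (A , B , C) →
                   l ++ c ++ r ↭ O → l ↭ A × c ↭ B × r ↭ C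
    classifies-↭ {l} {c} {r} {A} {B} {C} t∈ cl@(inA , inB , inC) lcr↭O =
      unique∧set⇒↭ !l !A (mk⇔ (λ z∈l → proj₁ (classified (∈-++⁺ˡ z∈l)) z∈l) (All.lookup inA)) ,
      unique∧set⇒↭ !c !B (mk⇔ (λ z∈c → proj₁ (proj₂ (classified (∈-++⁺ʳ l (∈-++⁺ˡ z∈c)))) (λ z∈l → l#c z∈l z∈c) z∈c)
                               (proj₂ ∘ All.lookup inB)) ,
      unique∧set⇒↭ !r !C (mk⇔ (λ z∈r → proj₂ (proj₂ (classified (∈-++⁺ʳ l (∈-++⁺ʳ c z∈r))))
                                          (λ z∈l → l#r z∈l z∈r) (λ z∈c → c#r z∈c z∈r))
                               C⊆r)
      where
      open UniqueBlocks (↭-UniqueBlocks {xs = l} {c} {r} !O lcr↭O)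
        renaming (!₁ to !l; !₂ to !c; !₃ to !r; #₁₂ to l#c; #₁₃ to l#r; #₂₃ to c#r)
      open UniqueBlocks (∈-tripartitions⇒UniqueBlocks O !O t∈) using () renaming (!₁ to !A; !₂ to !B; !₃ to !C)
      classified : ∀ {z} → z ∈ l ++ c ++ r → (z ∈ l → z ∈ A) × (z ∉ l → z ∈ c → z ∈ B) × (z ∉ l → z ∉ c → z ∈ C)
      classified z∈lcr = ∈-classified O t∈ cl (∈-resp-↭ lcr↭O z∈lcr)
      C⊆r : ∀ {z} → z ∈ C → z ∈ r
      C⊆r z∈C with All.lookup inC z∈C
      ... | z∉l , z∉c with ∈-++⁻ l (∈-resp-↭ (↭-sym lcr↭O) (∈-resp-↭ (∈-tripartitions⇒↭ O t∈) (∈-++⁺ʳ A (∈-++⁺ʳ B z∈C))))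
      ...   | inj₁ z∈l = ⊥-elim (z∉l z∈l)
      ...   | inj₂ z∈cr with ∈-++⁻ c z∈cr
      ...     | inj₁ z∈c = ⊥-elim (z∉c z∈c)
      ...     | inj₂ z∈r = z∈r

  InRange : ℕ → ℕ → Set
  InRange n a = 1 ≤ a × a ≤ n

  ∈-words⁻ : ∀ {k n w} → w ∈ words k n → length w ≡ k × All (InRange n) w
  ∈-words⁻ {zero} (here refl) = refl , []
  ∈-words⁻ {suc k} {n} w∈ with find (∈-concatMap⁻ (λ v → map (v ∷_) (words k n)) {xs = map suc (upTo n)} w∈)
  ... | v , v∈ , w∈′ with ∈-map⁻ (v ∷_) w∈′ | ∈-map⁻ suc v∈
  ... | u , u∈ , refl | i , i∈ , refl with ∈-words⁻ {k} u∈
  ... | |u|≡k , u-range = cong suc |u|≡k , (s≤s z≤n , ∈-upTo⁻ i∈) ∷ u-range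

  ∈-words⁺ : ∀ {k n w} → length w ≡ k → All (InRange n) w → w ∈ words k n
  ∈-words⁺ {zero} {n} {[]} _ _ = here refl
  ∈-words⁺ {suc k} {n} {suc i ∷ w} refl ((_ , i<n) ∷ w-range) =
    ∈-concatMap⁺ (λ v → map (v ∷_) (words k n)) {xs = map suc (upTo n)}
      (lose (∈-map⁺ suc (∈-upTo⁺ i<n)) (∈-map⁺ (suc i ∷_) (∈-words⁺ {k} refl w-range)))

  words-unique : ∀ k n → Unique (words k n)
  words-unique zero n = [] ∷ []
  words-unique (suc k) n =
    Unique-concatMap⁺ (λ v → map (v ∷_) (words k n)) (Unique.map⁺ ℕ.suc-injective (Unique.upTo⁺ n))
      (λ _ → Unique.map⁺ List.∷-injectiveʳ (words-unique k n)) fibres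
    where
    fibres : ∀ {a b w} → a ∈ map suc (upTo n) → b ∈ map suc (upTo n) →
             w ∈ map (a ∷_) (words k n) → w ∈ map (b ∷_) (words k n) → a ≡ b
    fibres _ _ w∈a w∈b with ∈-map⁻ _ w∈a | ∈-map⁻ _ w∈b
    ... | _ , _ , refl | _ , _ , refl = refl

  oneLeftOf⇒glue : ∀ n w → T (oneLeftOf n w) → ∃₂ λ l c → ∃ λ r → w ≡ glue n l c r
  oneLeftOf⇒glue n (a ∷ w) t with a ≡ᵇ 1 in a≡ᵇ1
  ... | true with find (any⁻ (_≡ᵇ n) w t)
  ...   | b , b∈w , b≡ᵇn with ℕ.≡ᵇ⇒≡ b n b≡ᵇn | ∈-∃++ b∈w | ℕ.≡ᵇ⇒≡ a 1 (Equivalence.from Bool.T-≡ a≡ᵇ1)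
  ...     | refl | c , r , refl | refl = [] , c , r , refl
  oneLeftOf⇒glue n (a ∷ w) t | false with a ≡ᵇ n
  ...   | true = ⊥-elim t
  ...   | false with oneLeftOf⇒glue n w t
  ...     | l , c , r , refl = a ∷ l , c , r , refl

  glue⇒oneLeftOf : ∀ n l c r → 1 ∉ l → n ∉ l → T (oneLeftOf n (glue n l c r))
  glue⇒oneLeftOf n [] c r _ _ =
    Equivalence.from Bool.T-≡ (∈⇒any-true (_≡ᵇ n) (∈-++⁺ʳ c (here refl)) (≡ᵇ-refl n))
  glue⇒oneLeftOf n (a ∷ l) c r 1∉ n∉
    rewrite ≢⇒≡ᵇ-false {a} {1} (λ eq → 1∉ (here (sym eq))) | ≢⇒≡ᵇ-false {a} {n} (λ eq → n∉ (here (sym eq)))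
    = glue⇒oneLeftOf n l c r (λ p → 1∉ (there p)) (λ p → n∉ (there p))

  glue-↭ : ∀ n l c r → glue n l c r ↭ 1 ∷ n ∷ l ++ c ++ r
  glue-↭ n l c r = ↭-trans (shift 1 l (c ++ n ∷ r)) (↭-prep 1 (↭-trans (++⁺ˡ l (shift n c r)) (shift n l (c ++ r))))

  interior : ℕ → List ℕ
  interior zero    = []
  interior (suc m) = suc (suc m) ∷ interior m

  interior-length : ∀ m → length (interior m) ≡ m
  interior-length zero = refl
  interior-length (suc m) = cong suc (interior-length m)

  ∈-interior⁻ : ∀ {m a} → a ∈ interior m → Interior (suc (suc m)) a
  ∈-interior⁻ {suc m} (here refl) = s≤s (s≤s z≤n) , ℕ.n<1+n _
  ∈-interior⁻ {suc m} (there a∈) with ∈-interior⁻ {m} a∈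
  ... | 1<a , a<n = 1<a , ℕ.m<n⇒m<1+n a<n

  ∈-interior⁺ : ∀ {m a} → Interior (suc (suc m)) a → a ∈ interior m
  ∈-interior⁺ {zero} (1<a , a<2) = ⊥-elim (ℕ.<⇒≱ 1<a (ℕ.≤-pred a<2))
  ∈-interior⁺ {suc m} {a} (1<a , a<n) with a ℕ.≟ suc (suc m)
  ... | yes refl = here refl
  ... | no a≢ = there (∈-interior⁺ (1<a , ℕ.≤∧≢⇒< (ℕ.≤-pred a<n) a≢))

  interior-decreasing : ∀ m → AllPairs _>_ (interior m)
  interior-decreasing zero = []
  interior-decreasing (suc m) = All.tabulate (λ a∈ → proj₂ (∈-interior⁻ a∈)) ∷ interior-decreasing m

  interior-unique : ∀ m → Unique (interior m)
  interior-unique m = AllPairs.map (λ a>b a≡b → ℕ.<-irrefl (sym a≡b) a>b) (interior-decreasing m)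

  gluings : ℕ → Tripartition → List (List ℕ)
  gluings n (A , B , C) =
    concatMap (λ l → concatMap (λ c → map (glue n l c) (permutations C)) (permutations B)) (permutations A)

  ∈-gluings⁻ : ∀ {n A B C w} → w ∈ gluings n (A , B , C) →
               ∃₂ λ l c → ∃ λ r → w ≡ glue n l c r × l ↭ A × c ↭ B × r ↭ C
  ∈-gluings⁻ {n} {A} {B} {C} w∈
    with find (∈-concatMap⁻ (λ l → concatMap (λ c → map (glue n l c) (permutations C)) (permutations B))
                            {xs = permutations A} w∈)
  ... | l , l∈ , w∈′ with find (∈-concatMap⁻ (λ c → map (glue n l c) (permutations C)) {xs = permutations B} w∈′)
  ... | c , c∈ , w∈″ with ∈-map⁻ (glue n l c) w∈″
  ... | r , r∈ , refl = l , c , r , refl , ∈-permutations⁻ A l∈ , ∈-permutations⁻ B c∈ , ∈-permutations⁻ C r∈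

  ∈-gluings⁺ : ∀ {n A B C l c r} → l ↭ A → c ↭ B → r ↭ C → glue n l c r ∈ gluings n (A , B , C)
  ∈-gluings⁺ {n} {A} {B} {C} {l} {c} l↭ c↭ r↭ =
    ∈-concatMap⁺ (λ l → concatMap (λ c → map (glue n l c) (permutations C)) (permutations B)) {xs = permutations A}
      (lose (∈-permutations⁺ A l↭) (∈-concatMap⁺ (λ c → map (glue n l c) (permutations C)) {xs = permutations B}
        (lose (∈-permutations⁺ B c↭) (∈-map⁺ (glue n l c) (∈-permutations⁺ C r↭)))))

  glue-injective : ∀ {n l c r l′ c′ r′} → 1 ∉ l → 1 ∉ l′ → n ∉ c → n ∉ c′ →
                   glue n l c r ≡ glue n l′ c′ r′ → l ≡ l′ × c ≡ c′ × r ≡ r′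
  glue-injective {l = l} {c} {l′ = l′} {c′} 1∉l 1∉l′ n∉c n∉c′ eq with ++-∷-cancel l l′ 1∉l 1∉l′ eq
  ... | refl , eq′ with ++-∷-cancel c c′ n∉c n∉c′ eq′
  ... | refl , refl = refl , refl , refl

  gluings-unique : ∀ {n A B C} → Unique A → Unique B → Unique C → All (Interior n) A → All (Interior n) B →
                   Unique (gluings n (A , B , C))
  gluings-unique {n} {A} {B} {C} !A !B !C A-int B-int =
    Unique-concatMap⁺ (λ l → concatMap (glues l) (permutations B)) (permutations-unique !A)
      (λ l∈ → Unique-concatMap⁺ (glues _) (permutations-unique !B)
        (λ c∈ → Unique.map⁺ (λ eq → proj₂ (proj₂ (injective l∈ l∈ c∈ c∈ eq))) (permutations-unique !C))
        (λ c∈ c′∈ w∈ w∈′ → c-fibres l∈ c∈ c′∈ w∈ w∈′))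
      l-fibres
    where
    glues : List ℕ → List ℕ → List (List ℕ)
    glues l c = map (glue n l c) (permutations C)
    injective : ∀ {l l′ c c′ r r′} → l ∈ permutations A → l′ ∈ permutations A → c ∈ permutations B → c′ ∈ permutations B →
                glue n l c r ≡ glue n l′ c′ r′ → l ≡ l′ × c ≡ c′ × r ≡ r′
    injective l∈ l′∈ c∈ c′∈ =
      glue-injective (↭Interior⇒1∉ A-int (∈-permutations⁻ A l∈)) (↭Interior⇒1∉ A-int (∈-permutations⁻ A l′∈))
                     (↭Interior⇒n∉ B-int (∈-permutations⁻ B c∈)) (↭Interior⇒n∉ B-int (∈-permutations⁻ B c′∈))
    c-fibres : ∀ {l c c′ w} → l ∈ permutations A → c ∈ permutations B → c′ ∈ permutations B →
               w ∈ glues l c → w ∈ glues l c′ → c ≡ c′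
    c-fibres l∈ c∈ c′∈ w∈ w∈′ with ∈-map⁻ _ w∈ | ∈-map⁻ _ w∈′
    ... | _ , _ , refl | _ , _ , eq = proj₁ (proj₂ (injective l∈ l∈ c∈ c′∈ eq))
    l-fibres : ∀ {l l′ w} → l ∈ permutations A → l′ ∈ permutations A →
               w ∈ concatMap (glues l) (permutations B) → w ∈ concatMap (glues l′) (permutations B) → l ≡ l′
    l-fibres {l} {l′} l∈ l′∈ w∈ w∈′
      with find (∈-concatMap⁻ (glues l) {xs = permutations B} w∈) | find (∈-concatMap⁻ (glues l′) {xs = permutations B} w∈′)
    ... | c , c∈ , w∈″ | c′ , c′∈ , w∈‴ with ∈-map⁻ _ w∈″ | ∈-map⁻ _ w∈‴
    ... | _ , _ , refl | _ , _ , eq = proj₁ (injective l∈ l′∈ c∈ c′∈ eq)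

  allGluings : ℕ → List ℕ → List (List ℕ)
  allGluings n O = concatMap (gluings n) (tripartitions O)

  module _ (m : ℕ) where

    private
      n : ℕ
      n = suc (suc m)
      O : List ℕ
      O = interior m
      !O : Unique O
      !O = interior-unique m

    letters : List ℕ
    letters = 1 ∷ n ∷ O

    letters-unique : Unique letters
    letters-unique = All.tabulate (λ a∈ → 1≢ a∈) ∷ All.tabulate (λ a∈ n≡a → ℕ.<-irrefl (sym n≡a) (proj₂ (∈-interior⁻ a∈)))
                   ∷ !O
      where
      1≢ : ∀ {a} → a ∈ n ∷ O → 1 ≢ a
      1≢ (here refl) ()
      1≢ (there a∈) 1≡a = ℕ.<-irrefl 1≡a (proj₁ (∈-interior⁻ a∈))

    ∈-letters⁻ : ∀ {a} → a ∈ letters → InRange n a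
    ∈-letters⁻ (here refl) = s≤s z≤n , s≤s z≤n
    ∈-letters⁻ (there (here refl)) = s≤s z≤n , ℕ.≤-refl
    ∈-letters⁻ (there (there a∈)) with ∈-interior⁻ a∈
    ... | 1<a , a<n = ℕ.<⇒≤ 1<a , ℕ.<⇒≤ a<n

    ∈-letters⁺ : ∀ {a} → InRange n a → a ∈ letters
    ∈-letters⁺ {a} (1≤a , a≤n) with a ℕ.≟ 1 | a ℕ.≟ n
    ... | yes refl | _ = here refl
    ... | no _ | yes refl = there (here refl)
    ... | no a≢1 | no a≢n = there (there (∈-interior⁺ (ℕ.≤∧≢⇒< 1≤a (λ eq → a≢1 (sym eq)) , ℕ.≤∧≢⇒< a≤n a≢n)))

    ∈-S1n⁻ : ∀ {w} → w ∈ S1n n → ∃₂ λ l c → ∃ λ r → w ≡ glue n l c r × l ++ c ++ r ↭ O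
    ∈-S1n⁻ {w} w∈ with ∈-filter⁻ (λ w → T? (isPerm n w ∧ oneLeftOf n w)) {xs = words n n} w∈
    ... | w∈words , w-S1n with Equivalence.to (Bool.T-∧ {isPerm n w}) w-S1n
    ... | w-perm , w-left with Equivalence.to (Bool.T-∧ {length w ≡ᵇ n}) w-perm | ∈-words⁻ {n} {n} w∈words
    ... | _ , w-unique | |w|≡n , w-range with oneLeftOf⇒glue n w w-left
    ... | l , c , r , refl = l , c , r , refl , drop-∷ (drop-∷ (↭-trans (↭-sym (glue-↭ n l c r)) w↭letters))
      where
      w⊆letters : ∀ {a} → a ∈ glue n l c r → a ∈ letters
      w⊆letters a∈ = ∈-letters⁺ (All.lookup w-range a∈)
      |letters|≤|w| : length letters ≤ length (glue n l c r)
      |letters|≤|w| = ℕ.≤-reflexive (trans (cong (suc ∘ suc) (interior-length m)) (sym |w|≡n))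
      w↭letters : glue n l c r ↭ letters
      w↭letters = unique∧set⇒↭ (toWitness w-unique) letters-unique
        (mk⇔ w⊆letters (Unique-⊆-length≥⇒⊇ ℕ._≟_ (toWitness w-unique) w⊆letters |letters|≤|w|))

    ∈-S1n⁺ : ∀ l c r → l ++ c ++ r ↭ O → glue n l c r ∈ S1n n
    ∈-S1n⁺ l c r lcr↭ =
      ∈-filter⁺ (λ w → T? (isPerm n w ∧ oneLeftOf n w)) (∈-words⁺ |w|≡n w-range)
        (Equivalence.from (Bool.T-∧ {isPerm n (glue n l c r)})
          (Equivalence.from (Bool.T-∧ {length (glue n l c r) ≡ᵇ n}) (ℕ.≡⇒≡ᵇ _ _ |w|≡n , fromWitness w-unique) ,
           glue⇒oneLeftOf n l c r (↭Interior⇒1∉ l-interior ↭-refl) (↭Interior⇒n∉ l-interior ↭-refl)))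
      where
      w↭letters : glue n l c r ↭ letters
      w↭letters = ↭-trans (glue-↭ n l c r) (↭-prep 1 (↭-prep n lcr↭))
      w-unique : Unique (glue n l c r)
      w-unique = Unique-resp-↭ (↭-sym w↭letters) letters-unique
      w-range : All (InRange n) (glue n l c r)
      w-range = All-resp-↭ (↭-sym w↭letters) (All.tabulate ∈-letters⁻)
      |w|≡n : length (glue n l c r) ≡ n
      |w|≡n = trans (↭-length w↭letters) (cong (suc ∘ suc) (interior-length m))
      l-interior : All (Interior n) l
      l-interior = proj₁ (All.++⁻ l (All-resp-↭ (↭-sym lcr↭) (All.tabulate ∈-interior⁻)))

    ∈-allGluings⁻ : ∀ {w} → w ∈ allGluings n O → ∃₂ λ l c → ∃ λ r → w ≡ glue n l c r × l ++ c ++ r ↭ O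
    ∈-allGluings⁻ w∈ with find (∈-concatMap⁻ (gluings n) {xs = tripartitions O} w∈)
    ... | (A , B , C) , t∈ , w∈′ with ∈-gluings⁻ {n} {A} {B} {C} w∈′
    ... | l , c , r , refl , l↭A , c↭B , r↭C =
      l , c , r , refl , ↭-trans (++⁺ l↭A (++⁺ c↭B r↭C)) (∈-tripartitions⇒↭ O t∈)

    ∈-allGluings⁺ : ∀ l c r → l ++ c ++ r ↭ O → glue n l c r ∈ allGluings n O
    ∈-allGluings⁺ l c r lcr↭O with classifies-↭ !O (classify-∈ l c O) (classify-classifies l c O) lcr↭O
    ... | l↭A , c↭B , r↭C =
      ∈-concatMap⁺ (gluings n) {xs = tripartitions O} (lose (classify-∈ l c O) (∈-gluings⁺ {n} l↭A c↭B r↭C))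

    allGluings-unique : Unique (allGluings n O)
    allGluings-unique = Unique-concatMap⁺ (gluings n) (tripartitions-unique !O) gluings-unique′ fibres
      where
      blocks-interior : ∀ {A B C} → (A , B , C) ∈ tripartitions O → All (Interior n) A × All (Interior n) B × All (Interior n) C
      blocks-interior = All-tripartition O (All.tabulate ∈-interior⁻)
      gluings-unique′ : ∀ {t} → t ∈ tripartitions O → Unique (gluings n t)
      gluings-unique′ {A , B , C} t∈ =
        gluings-unique !A !B !C (proj₁ (blocks-interior t∈)) (proj₁ (proj₂ (blocks-interior t∈)))
        where open UniqueBlocks (∈-tripartitions⇒UniqueBlocks O !O t∈) renaming (!₁ to !A; !₂ to !B; !₃ to !C)
      1∉ : ∀ {A B C l} → (A , B , C) ∈ tripartitions O → l ↭ A → 1 ∉ l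
      1∉ t∈ = ↭Interior⇒1∉ (proj₁ (blocks-interior t∈))
      n∉ : ∀ {A B C c} → (A , B , C) ∈ tripartitions O → c ↭ B → n ∉ c
      n∉ t∈ = ↭Interior⇒n∉ (proj₁ (proj₂ (blocks-interior t∈)))
      fibres : ∀ {t t′ w} → t ∈ tripartitions O → t′ ∈ tripartitions O → w ∈ gluings n t → w ∈ gluings n t′ → t ≡ t′
      fibres {A , B , C} {A′ , B′ , C′} t∈ t′∈ w∈ w∈′
        with ∈-gluings⁻ {n} {A} {B} {C} w∈ | ∈-gluings⁻ {n} {A′} {B′} {C′} w∈′
      ... | l , c , r , refl , l↭A , c↭B , _ | l′ , c′ , r′ , eq , l′↭A′ , c′↭B′ , _
        with glue-injective (1∉ t∈ l↭A) (1∉ t′∈ l′↭A′) (n∉ t∈ c↭B) (n∉ t′∈ c′↭B′) eq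
      ... | refl , refl , _ =
        trans (classifies⇒≡classify O t∈ (↭-classifies !O t∈ l↭A c↭B))
              (sym (classifies⇒≡classify O t′∈ (↭-classifies !O t′∈ l′↭A′ c′↭B′)))

    S1n↭allGluings : S1n n ↭ allGluings n O
    S1n↭allGluings =
      unique∧set⇒↭ (Unique.filter⁺ (λ w → T? (isPerm n w ∧ oneLeftOf n w)) (words-unique n n)) allGluings-unique
        (mk⇔ S1n⊆allGluings allGluings⊆S1n)
      where
      S1n⊆allGluings : ∀ {w} → w ∈ S1n n → w ∈ allGluings n O
      S1n⊆allGluings w∈ with ∈-S1n⁻ w∈
      ... | l , c , r , refl , lcr↭O = ∈-allGluings⁺ l c r lcr↭O
      allGluings⊆S1n : ∀ {w} → w ∈ allGluings n O → w ∈ S1n n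
      allGluings⊆S1n w∈ with ∈-allGluings⁻ w∈
      ... | l , c , r , refl , lcr↭O = ∈-S1n⁺ l c r lcr↭O

module Weights {c ℓ : Level} (R : CommutativeSemiring c ℓ) (x : CommutativeSemiring.Carrier R) where

  open Combinatorics
  open import Data.Nat using (ℕ; zero; suc; _<_; _>_; _<ᵇ_; _∸_) renaming (_+_ to _+ℕ_; _*_ to _*ℕ_)
  import Data.Nat.Properties as ℕ
  open import Data.Bool using (true; if_then_else_)
  open import Data.Bool.ListAction using (any)
  open import Data.List using (List; []; _∷_; _++_; [_]; map; concatMap; foldr; length)
  import Data.List.Properties as List
  open import Data.List.Membership.Propositional using (_∈_)
  open import Data.List.Membership.Propositional.Properties using (∈-++⁺ʳ)
  open import Data.List.Relation.Unary.Any using (here; there)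
  open import Data.List.Relation.Unary.All as All using (All; []; _∷_)
  open import Data.List.Relation.Unary.AllPairs using (AllPairs; []; _∷_)
  open import Data.List.Relation.Unary.Unique.Propositional using (Unique)
  open import Data.List.Relation.Binary.Permutation.Propositional as ↭ using (_↭_)
  open import Data.List.Relation.Binary.Permutation.Propositional.Properties using (All-resp-↭; ↭-length)
  open import Data.Product using (_,_)
  open import Relation.Binary.PropositionalEquality as ≡ using (_≡_; cong)
  open CommutativeSemiring R
  open Poly R using (B; prod; two; egfRHS; evenRHS; oddRHS; _^_; _×_)
  open import Algebra.Properties.Semiring.Mult semiring using (×-homo-+; ×-assoc-*)
  open import Algebra.Properties.Semiring.Exp semiring using (^-homo-*)
  open import Algebra.Solver.Ring.NaturalCoefficients.Default R using (solve; _:+_; _:*_; _:=_)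
  open import Relation.Binary.Reasoning.Setoid setoid

  -- Shaped so that B n x is, by definition, ∑ (λ w → x ^ mmp1010 w) (S1n n).
  ∑ : {A : Set} → (A → Carrier) → List A → Carrier
  ∑ f = foldr (λ a acc → f a + acc) 0#

  module _ {A : Set} where

    ∑-cong : ∀ {f g : A → Carrier} xs → (∀ {a} → a ∈ xs → f a ≈ g a) → ∑ f xs ≈ ∑ g xs
    ∑-cong [] _ = refl
    ∑-cong (a ∷ xs) f≈g = +-cong (f≈g (here ≡.refl)) (∑-cong xs (λ a∈ → f≈g (there a∈)))

    ∑-++ : ∀ (f : A → Carrier) xs ys → ∑ f (xs ++ ys) ≈ ∑ f xs + ∑ f ys
    ∑-++ f [] ys = sym (+-identityˡ _)
    ∑-++ f (a ∷ xs) ys = trans (+-congˡ (∑-++ f xs ys)) (sym (+-assoc _ _ _))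

    ∑-*ˡ : ∀ k (f : A → Carrier) xs → ∑ (λ a → k * f a) xs ≈ k * ∑ f xs
    ∑-*ˡ k f [] = sym (zeroʳ k)
    ∑-*ˡ k f (a ∷ xs) = trans (+-congˡ (∑-*ˡ k f xs)) (sym (distribˡ k (f a) (∑ f xs)))

    ∑-*ʳ : ∀ k (f : A → Carrier) xs → ∑ (λ a → f a * k) xs ≈ ∑ f xs * k
    ∑-*ʳ k f xs = trans (∑-cong xs (λ {a} _ → *-comm (f a) k)) (trans (∑-*ˡ k f xs) (*-comm k (∑ f xs)))

    ∑-+ : ∀ (f g : A → Carrier) xs → ∑ (λ a → f a + g a) xs ≈ ∑ f xs + ∑ g xs
    ∑-+ f g [] = sym (+-identityʳ 0#)
    ∑-+ f g (a ∷ xs) = trans (+-congˡ (∑-+ f g xs))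
      (solve 4 (λ p q r s → (p :+ q) :+ (r :+ s) := (p :+ r) :+ (q :+ s)) refl (f a) (g a) (∑ f xs) (∑ g xs))

    ∑-const : ∀ k (xs : List A) → ∑ (λ _ → k) xs ≈ length xs × k
    ∑-const k [] = refl
    ∑-const k (a ∷ xs) = +-congˡ (∑-const k xs)

    ∑-↭ : ∀ (f : A → Carrier) {xs ys} → xs ↭ ys → ∑ f xs ≈ ∑ f ys
    ∑-↭ f ↭.refl = refl
    ∑-↭ f (↭.prep a xs↭ys) = +-congˡ (∑-↭ f xs↭ys)
    ∑-↭ f (↭.swap {ys = ys} a b xs↭ys) = trans (+-congˡ (+-congˡ (∑-↭ f xs↭ys)))
      (solve 3 (λ p q r → p :+ (q :+ r) := q :+ (p :+ r)) refl (f a) (f b) (∑ f ys))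
    ∑-↭ f (↭.trans xs↭ys ys↭zs) = trans (∑-↭ f xs↭ys) (∑-↭ f ys↭zs)

  module _ {A B : Set} where

    ∑-map : ∀ (f : B → Carrier) (g : A → B) xs → ∑ f (map g xs) ≈ ∑ (λ a → f (g a)) xs
    ∑-map f g [] = refl
    ∑-map f g (a ∷ xs) = +-congˡ (∑-map f g xs)

    ∑-concatMap : ∀ (f : B → Carrier) (g : A → List B) xs → ∑ f (concatMap g xs) ≈ ∑ (λ a → ∑ f (g a)) xs
    ∑-concatMap f g [] = refl
    ∑-concatMap f g (a ∷ xs) = trans (∑-++ f (g a) (concatMap g xs)) (+-congˡ (∑-concatMap f g xs))

  x^-cong : ∀ {a b} → a ≡ b → x ^ a ≈ x ^ b
  x^-cong a≡b = reflexive (cong (x ^_) a≡b)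

  ∑-insertions-nonLtrMinima : ∀ {e} pre w → All (_< e) w →
    ∑ (λ v → x ^ nonLtrMinima pre v) (insertions e w)
      ≈ (x ^ (if any (_<ᵇ e) pre then 1 else 0) + length w × x) * x ^ nonLtrMinima pre w
  ∑-insertions-nonLtrMinima {e} pre [] _ = begin
    x ^ (Iₑ +ℕ 0) + 0#   ≈⟨ +-identityʳ _ ⟩
    x ^ (Iₑ +ℕ 0)        ≈⟨ x^-cong (ℕ.+-identityʳ Iₑ) ⟩
    x ^ Iₑ               ≈⟨ sym (*-identityʳ _) ⟩
    x ^ Iₑ * 1#          ≈⟨ *-congʳ (sym (+-identityʳ _)) ⟩
    (x ^ Iₑ + 0#) * 1#   ∎
    where Iₑ = if any (_<ᵇ e) pre then 1 else 0
  ∑-insertions-nonLtrMinima {e} pre (y ∷ ys) (y<e ∷ ys<e) = begin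
    x ^ (Iₑ +ℕ nonLtrMinima (pre ++ [ e ]) (y ∷ ys)) + ∑ (λ v → x ^ nonLtrMinima pre v) (map (y ∷_) (insertions e ys))
      ≈⟨ +-cong (x^-cong (cong (Iₑ +ℕ_) e-invisible)) (∑-map _ (y ∷_) (insertions e ys)) ⟩
    x ^ (Iₑ +ℕ L) + ∑ (λ v → x ^ (Iᵧ +ℕ nonLtrMinima (pre ++ [ y ]) v)) (insertions e ys)
      ≈⟨ +-cong (^-homo-* x Iₑ L) (∑-cong (insertions e ys) (λ {v} _ → ^-homo-* x Iᵧ (nonLtrMinima (pre ++ [ y ]) v))) ⟩
    x ^ Iₑ * x ^ L + ∑ (λ v → x ^ Iᵧ * x ^ nonLtrMinima (pre ++ [ y ]) v) (insertions e ys)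
      ≈⟨ +-congˡ (trans (∑-*ˡ (x ^ Iᵧ) _ (insertions e ys)) (*-congˡ (∑-insertions-nonLtrMinima (pre ++ [ y ]) ys ys<e))) ⟩
    x ^ Iₑ * x ^ L + x ^ Iᵧ * ((x ^ (if any (_<ᵇ e) (pre ++ [ y ]) then 1 else 0) + length ys × x) * x ^ L′)
      ≈⟨ +-congˡ (*-congˡ (*-congʳ (+-congʳ (trans (x^-cong (cong (λ b → if b then 1 else 0) y-smaller)) (*-identityʳ x))))) ⟩
    x ^ Iₑ * x ^ L + x ^ Iᵧ * ((x + length ys × x) * x ^ L′)
      ≈⟨ +-congˡ (solve 4 (λ b X N c → b :* ((X :+ N) :* c) := (X :+ N) :* (b :* c)) refl (x ^ Iᵧ) x (length ys × x) (x ^ L′)) ⟩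
    x ^ Iₑ * x ^ L + (x + length ys × x) * (x ^ Iᵧ * x ^ L′)
      ≈⟨ +-congˡ (*-congˡ (sym (^-homo-* x Iᵧ L′))) ⟩
    x ^ Iₑ * x ^ L + (x + length ys × x) * x ^ L
      ≈⟨ sym (distribʳ (x ^ L) (x ^ Iₑ) (x + length ys × x)) ⟩
    (x ^ Iₑ + (x + length ys × x)) * x ^ L ∎
    where
    Iₑ = if any (_<ᵇ e) pre then 1 else 0
    Iᵧ = if any (_<ᵇ y) pre then 1 else 0
    L = nonLtrMinima pre (y ∷ ys)
    L′ = nonLtrMinima (pre ++ [ y ]) ys
    e-invisible : nonLtrMinima (pre ++ [ e ]) (y ∷ ys) ≡ L
    e-invisible = ≡.trans (nonLtrMinima-drop-larger pre [] (y ∷ ys) (y<e ∷ ys<e)) (cong (λ p → nonLtrMinima p (y ∷ ys)) (List.++-identityʳ pre))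
    y-smaller : any (_<ᵇ e) (pre ++ [ y ]) ≡ true
    y-smaller = ∈⇒any-true (_<ᵇ e) (∈-++⁺ʳ pre (here ≡.refl)) (<⇒<ᵇ-true y<e)

  ∑-insertions-nonRtlMaxima : ∀ {e} w → All (e <_) w →
    ∑ (λ v → x ^ nonRtlMaxima v) (insertions e w) ≈ (1# + length w × x) * x ^ nonRtlMaxima w
  ∑-insertions-nonRtlMaxima [] _ = trans (+-identityʳ _) (trans (sym (*-identityʳ 1#)) (*-congʳ (sym (+-identityʳ 1#))))
  ∑-insertions-nonRtlMaxima {e} (y ∷ ys) (e<y ∷ e<ys) = begin
    x ^ ((if any (e <ᵇ_) (y ∷ ys) then 1 else 0) +ℕ Rₘ) + ∑ (λ v → x ^ nonRtlMaxima v) (map (y ∷_) (insertions e ys))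
      ≈⟨ +-cong (x^-cong (cong (λ b → (if b then 1 else 0) +ℕ Rₘ) (∈⇒any-true (e <ᵇ_) {y} {y ∷ ys} (here ≡.refl) (<⇒<ᵇ-true e<y))))
                (∑-map (λ v → x ^ nonRtlMaxima v) (y ∷_) (insertions e ys)) ⟩
    x * x ^ Rₘ + ∑ (λ v → x ^ ((if any (y <ᵇ_) v then 1 else 0) +ℕ nonRtlMaxima v)) (insertions e ys)
      ≈⟨ +-congˡ (∑-cong (insertions e ys) (λ {v} v∈ →
           trans (x^-cong (cong (λ b → (if b then 1 else 0) +ℕ nonRtlMaxima v)
                                (any-insertions (y <ᵇ_) ys v∈ (≥⇒<ᵇ-false (ℕ.<⇒≤ e<y)))))
                 (^-homo-* x Iᵧ (nonRtlMaxima v)))) ⟩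
    x * x ^ Rₘ + ∑ (λ v → x ^ Iᵧ * x ^ nonRtlMaxima v) (insertions e ys)
      ≈⟨ +-congˡ (trans (∑-*ˡ (x ^ Iᵧ) (λ v → x ^ nonRtlMaxima v) (insertions e ys)) (*-congˡ (∑-insertions-nonRtlMaxima ys e<ys))) ⟩
    x * x ^ Rₘ + x ^ Iᵧ * ((1# + length ys × x) * x ^ nonRtlMaxima ys)
      ≈⟨ +-congʳ (*-congˡ (^-homo-* x Iᵧ (nonRtlMaxima ys))) ⟩
    x * (x ^ Iᵧ * x ^ nonRtlMaxima ys) + x ^ Iᵧ * ((1# + length ys × x) * x ^ nonRtlMaxima ys)
      ≈⟨ solve 5 (λ X b c o N → X :* (b :* c) :+ b :* ((o :+ N) :* c) := (o :+ (X :+ N)) :* (b :* c)) refl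
               x (x ^ Iᵧ) (x ^ nonRtlMaxima ys) 1# (length ys × x) ⟩
    (1# + (x + length ys × x)) * (x ^ Iᵧ * x ^ nonRtlMaxima ys)
      ≈⟨ *-congˡ (sym (^-homo-* x Iᵧ (nonRtlMaxima ys))) ⟩
    (1# + (x + length ys × x)) * x ^ Rₘ ∎
    where
    Rₘ = nonRtlMaxima (y ∷ ys)
    Iᵧ = if any (y <ᵇ_) ys then 1 else 0

  ∑-insertions-length : ∀ {A : Set} (e : A) w → ∑ (λ v → x ^ length v) (insertions e w) ≈ (suc (length w) × x) * x ^ length w
  ∑-insertions-length e w = begin
    ∑ (λ v → x ^ length v) (insertions e w)     ≈⟨ ∑-cong (insertions e w) (λ v∈ → x^-cong (↭-length (∈-insertions⇒↭ w v∈))) ⟩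
    ∑ (λ _ → x * x ^ length w) (insertions e w) ≈⟨ ∑-const _ (insertions e w) ⟩
    length (insertions e w) × (x * x ^ length w) ≈⟨ reflexive (cong (_× (x * x ^ length w)) (insertions-length e w)) ⟩
    suc (length w) × (x * x ^ length w)          ≈⟨ sym (×-assoc-* (suc (length w)) x (x ^ length w)) ⟩
    (suc (length w) × x) * x ^ length w         ∎

  prodFrom : (ℕ → Carrier) → ℕ → ℕ → Carrier
  prodFrom g i zero    = 1#
  prodFrom g i (suc k) = g i * prodFrom g (suc i) k

  prodFrom-suc : ∀ g i k → prodFrom g i (suc k) ≈ prodFrom g i k * g (i +ℕ k)
  prodFrom-suc g i zero = trans (*-identityʳ (g i)) (trans (reflexive (cong g (≡.sym (ℕ.+-identityʳ i)))) (sym (*-identityˡ _)))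
  prodFrom-suc g i (suc k) = begin
    g i * prodFrom g (suc i) (suc k)              ≈⟨ *-congˡ (prodFrom-suc g (suc i) k) ⟩
    g i * (prodFrom g (suc i) k * g (suc i +ℕ k)) ≈⟨ sym (*-assoc _ _ _) ⟩
    (g i * prodFrom g (suc i) k) * g (suc i +ℕ k) ≈⟨ *-congˡ (reflexive (cong g (≡.sym (ℕ.+-suc i k)))) ⟩
    (g i * prodFrom g (suc i) k) * g (i +ℕ suc k) ∎

  ∑-permutations : ∀ {A : Set} {_≺_ : A → A → Set} (f : List A → Carrier) (g : ℕ → Carrier) → f [] ≈ 1# →
                   (∀ {e w} → All (e ≺_) w → ∑ f (insertions e w) ≈ g (length w) * f w) →
                   ∀ {xs} → AllPairs _≺_ xs → ∑ f (permutations xs) ≈ prodFrom g 0 (length xs)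
  ∑-permutations f g f[]≈1 step {[]} [] = trans (+-identityʳ _) f[]≈1
  ∑-permutations f g f[]≈1 step {e ∷ xs} (e≺xs ∷ ≺xs) = begin
    ∑ f (concatMap (insertions e) (permutations xs))     ≈⟨ ∑-concatMap f (insertions e) (permutations xs) ⟩
    ∑ (λ u → ∑ f (insertions e u)) (permutations xs)     ≈⟨ ∑-cong (permutations xs) insert ⟩
    ∑ (λ u → g (length xs) * f u) (permutations xs)      ≈⟨ ∑-*ˡ (g (length xs)) f (permutations xs) ⟩
    g (length xs) * ∑ f (permutations xs)                ≈⟨ *-congˡ (∑-permutations f g f[]≈1 step ≺xs) ⟩
    g (length xs) * prodFrom g 0 (length xs)             ≈⟨ *-comm _ _ ⟩
    prodFrom g 0 (length xs) * g (length xs)             ≈⟨ sym (prodFrom-suc g 0 (length xs)) ⟩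
    prodFrom g 0 (suc (length xs))                       ∎
    where
    insert : ∀ {u} → u ∈ permutations xs → ∑ f (insertions e u) ≈ g (length xs) * f u
    insert u∈ = trans (step (All-resp-↭ (↭.↭-sym (∈-permutations⁻ xs u∈)) e≺xs))
                      (*-congʳ (reflexive (cong g (↭-length (∈-permutations⁻ xs u∈)))))

  1+ix : ℕ → Carrier
  1+ix i = 1# + i × x

  [1+i]x : ℕ → Carrier
  [1+i]x i = suc i × x

  2+ix : ℕ → Carrier
  2+ix i = two + i × x

  ∑-permutations-nonLtrMinima : ∀ {xs} → AllPairs _>_ xs → ∑ (λ w → x ^ nonLtrMinima [] w) (permutations xs) ≈ prodFrom 1+ix 0 (length xs)
  ∑-permutations-nonLtrMinima = ∑-permutations _ 1+ix refl (∑-insertions-nonLtrMinima [] _)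

  ∑-permutations-nonRtlMaxima : ∀ {xs} → AllPairs _<_ xs → ∑ (λ w → x ^ nonRtlMaxima w) (permutations xs) ≈ prodFrom 1+ix 0 (length xs)
  ∑-permutations-nonRtlMaxima = ∑-permutations _ 1+ix refl (∑-insertions-nonRtlMaxima _)

  ∑-permutations-length : ∀ {A : Set} {xs : List A} → Unique xs → ∑ (λ w → x ^ length w) (permutations xs) ≈ prodFrom [1+i]x 0 (length xs)
  ∑-permutations-length = ∑-permutations _ [1+i]x refl (λ {e} {w} _ → ∑-insertions-length e w)

  blockWeight : ℕ → ℕ → ℕ → Tripartition {ℕ} → Carrier
  blockWeight i j k (A , B , C) = prodFrom 1+ix i (length A) * (prodFrom [1+i]x j (length B) * prodFrom 1+ix k (length C))

  ∑-extend : ∀ i j k e t → ∑ (blockWeight i j k) (extend e t) ≈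
             1+ix i * blockWeight (suc i) j k t + ([1+i]x j * blockWeight i (suc j) k t + 1+ix k * blockWeight i j (suc k) t)
  ∑-extend i j k e (A , B , C) =
    +-cong (*-assoc _ _ _)
      (+-cong (solve 4 (λ p g q r → p :* ((g :* q) :* r) := g :* (p :* (q :* r))) refl
                 (prodFrom 1+ix i (length A)) ([1+i]x j) (prodFrom [1+i]x (suc j) (length B)) (prodFrom 1+ix k (length C)))
        (trans (+-identityʳ _)
          (trans (*-congˡ (*-congˡ (reflexive (cong (prodFrom 1+ix k) |C++e|≡))))
            (solve 4 (λ p q g r → p :* (q :* (g :* r)) := g :* (p :* (q :* r))) refl
              (prodFrom 1+ix i (length A)) (prodFrom [1+i]x j (length B)) (1+ix k) (prodFrom 1+ix (suc k) (length C))))))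
    where
    |C++e|≡ : length (C ++ [ e ]) ≡ suc (length C)
    |C++e|≡ = ≡.trans (List.length-++ C) (ℕ.+-comm (length C) 1)

  1+ix+[1+j]x+1+kx : ∀ i j k → 1+ix i + ([1+i]x j + 1+ix k) ≈ 2+ix (suc (i +ℕ j +ℕ k))
  1+ix+[1+j]x+1+kx i j k = begin
    (1# + i × x) + ((x + j × x) + (1# + k × x))
      ≈⟨ solve 5 (λ o X I J K → (o :+ I) :+ ((X :+ J) :+ (o :+ K)) := (o :+ o) :+ (X :+ ((I :+ J) :+ K))) refl 1# x (i × x) (j × x) (k × x) ⟩
    (1# + 1#) + (x + ((i × x + j × x) + k × x))
      ≈⟨ +-congˡ (+-congˡ (trans (+-congʳ (sym (×-homo-+ x i j))) (sym (×-homo-+ x (i +ℕ j) k)))) ⟩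
    (1# + 1#) + (x + (i +ℕ j +ℕ k) × x) ∎

  -- Generalising the starting points i, j, k lets the induction go through: the new letter shifts
  -- the starting point of the block it joins.
  ∑-tripartitions : ∀ O i j k → ∑ (blockWeight i j k) (tripartitions O) ≈ prodFrom 2+ix (suc (i +ℕ j +ℕ k)) (length O)
  ∑-tripartitions [] i j k = trans (+-identityʳ _) (trans (*-identityˡ _) (*-identityˡ _))
  ∑-tripartitions (e ∷ O) i j k = begin
    ∑ (blockWeight i j k) (concatMap (extend e) (tripartitions O))
      ≈⟨ ∑-concatMap (blockWeight i j k) (extend e) (tripartitions O) ⟩
    ∑ (λ t → ∑ (blockWeight i j k) (extend e t)) (tripartitions O)
      ≈⟨ ∑-cong (tripartitions O) (λ {t} _ → ∑-extend i j k e t) ⟩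
    ∑ (λ t → 1+ix i * W₁ t + ([1+i]x j * W₂ t + 1+ix k * W₃ t)) (tripartitions O)
      ≈⟨ trans (∑-+ _ _ (tripartitions O)) (+-congˡ (∑-+ _ _ (tripartitions O))) ⟩
    ∑ (λ t → 1+ix i * W₁ t) (tripartitions O) + (∑ (λ t → [1+i]x j * W₂ t) (tripartitions O) + ∑ (λ t → 1+ix k * W₃ t) (tripartitions O))
      ≈⟨ +-cong (∑-*ˡ (1+ix i) W₁ (tripartitions O)) (+-cong (∑-*ˡ ([1+i]x j) W₂ (tripartitions O)) (∑-*ˡ (1+ix k) W₃ (tripartitions O))) ⟩
    1+ix i * ∑ W₁ (tripartitions O) + ([1+i]x j * ∑ W₂ (tripartitions O) + 1+ix k * ∑ W₃ (tripartitions O))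
      ≈⟨ +-cong (*-congˡ (∑-tripartitions O (suc i) j k))
           (+-cong (*-congˡ (trans (∑-tripartitions O i (suc j) k) (reflexive (cong (λ s → prodFrom 2+ix (suc s) (length O)) i+[1+j]+k≡))))
                   (*-congˡ (trans (∑-tripartitions O i j (suc k)) (reflexive (cong (λ s → prodFrom 2+ix (suc s) (length O)) i+j+[1+k]≡))))) ⟩
    1+ix i * P + ([1+i]x j * P + 1+ix k * P)
      ≈⟨ solve 4 (λ a b d p → a :* p :+ (b :* p :+ d :* p) := (a :+ (b :+ d)) :* p) refl (1+ix i) ([1+i]x j) (1+ix k) P ⟩
    (1+ix i + ([1+i]x j + 1+ix k)) * P
      ≈⟨ *-congʳ (1+ix+[1+j]x+1+kx i j k) ⟩
    2+ix (suc (i +ℕ j +ℕ k)) * P ∎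
    where
    W₁ = blockWeight (suc i) j k
    W₂ = blockWeight i (suc j) k
    W₃ = blockWeight i j (suc k)
    P = prodFrom 2+ix (suc (suc (i +ℕ j +ℕ k))) (length O)
    i+[1+j]+k≡ : i +ℕ suc j +ℕ k ≡ suc (i +ℕ j +ℕ k)
    i+[1+j]+k≡ = cong (_+ℕ k) (ℕ.+-suc i j)
    i+j+[1+k]≡ : i +ℕ j +ℕ suc k ≡ suc (i +ℕ j +ℕ k)
    i+j+[1+k]≡ = ℕ.+-suc (i +ℕ j) k

  ∑-∑-∑-* : ∀ {A B C : Set} (f : A → Carrier) (g : B → Carrier) (h : C → Carrier) xs ys zs →
            ∑ (λ a → ∑ (λ b → ∑ (λ c → f a * (g b * h c)) zs) ys) xs ≈ ∑ f xs * (∑ g ys * ∑ h zs)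
  ∑-∑-∑-* f g h xs ys zs = begin
    ∑ (λ a → ∑ (λ b → ∑ (λ c → f a * (g b * h c)) zs) ys) xs
      ≈⟨ ∑-cong xs (λ {a} _ → ∑-cong ys (λ {b} _ → trans (∑-*ˡ (f a) _ zs) (*-congˡ (∑-*ˡ (g b) h zs)))) ⟩
    ∑ (λ a → ∑ (λ b → f a * (g b * ∑ h zs)) ys) xs
      ≈⟨ ∑-cong xs (λ {a} _ → trans (∑-*ˡ (f a) _ ys) (*-congˡ (∑-*ʳ (∑ h zs) g ys))) ⟩
    ∑ (λ a → f a * (∑ g ys * ∑ h zs)) xs
      ≈⟨ ∑-*ʳ (∑ g ys * ∑ h zs) f xs ⟩
    ∑ f xs * (∑ g ys * ∑ h zs) ∎

  ∑-gluings : ∀ {n A B C} → All (Interior n) A → All (Interior n) B → All (Interior n) C →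
              AllPairs _>_ A → Unique B → AllPairs _<_ C →
              ∑ (λ w → x ^ mmp1010 w) (gluings n (A , B , C)) ≈ blockWeight 0 0 0 (A , B , C)
  ∑-gluings {n} {A} {B} {C} A-int B-int C-int A-dec !B C-inc = begin
    ∑ wt (gluings n (A , B , C))
      ≈⟨ ∑-concatMap wt _ (permutations A) ⟩
    ∑ (λ l → ∑ wt (concatMap (λ c → map (glue n l c) (permutations C)) (permutations B))) (permutations A)
      ≈⟨ ∑-cong (permutations A) (λ {l} _ → trans (∑-concatMap wt _ (permutations B))
                                                  (∑-cong (permutations B) (λ {c} _ → ∑-map wt (glue n l c) (permutations C)))) ⟩
    ∑ (λ l → ∑ (λ c → ∑ (λ r → wt (glue n l c r)) (permutations C)) (permutations B)) (permutations A)
      ≈⟨ ∑-cong (permutations A) (λ l∈ → ∑-cong (permutations B) (λ c∈ → ∑-cong (permutations C) (λ r∈ → weight-glue l∈ c∈ r∈))) ⟩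
    ∑ (λ l → ∑ (λ c → ∑ (λ r → x ^ nonLtrMinima [] l * (x ^ length c * x ^ nonRtlMaxima r)) (permutations C)) (permutations B)) (permutations A)
      ≈⟨ ∑-∑-∑-* _ _ _ (permutations A) (permutations B) (permutations C) ⟩
    ∑ (λ l → x ^ nonLtrMinima [] l) (permutations A) * (∑ (λ c → x ^ length c) (permutations B) * ∑ (λ r → x ^ nonRtlMaxima r) (permutations C))
      ≈⟨ *-cong (∑-permutations-nonLtrMinima A-dec) (*-cong (∑-permutations-length !B) (∑-permutations-nonRtlMaxima C-inc)) ⟩
    blockWeight 0 0 0 (A , B , C) ∎
    where
    wt : List ℕ → Carrier
    wt w = x ^ mmp1010 w
    permutation-interior : ∀ {X w} → All (Interior n) X → w ∈ permutations X → All (Interior n) w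
    permutation-interior X-int w∈ = All-resp-↭ (↭.↭-sym (∈-permutations⁻ _ w∈)) X-int
    weight-glue : ∀ {l c r} → l ∈ permutations A → c ∈ permutations B → r ∈ permutations C →
            wt (glue n l c r) ≈ x ^ nonLtrMinima [] l * (x ^ length c * x ^ nonRtlMaxima r)
    weight-glue {l} {c} {r} l∈ c∈ r∈ = begin
      x ^ mmp1010 (glue n l c r)
        ≈⟨ x^-cong (mmp-glue n l c r (permutation-interior A-int l∈) (permutation-interior B-int c∈) (permutation-interior C-int r∈)) ⟩
      x ^ (nonLtrMinima [] l +ℕ (length c +ℕ nonRtlMaxima r))
        ≈⟨ trans (^-homo-* x (nonLtrMinima [] l) _) (*-congˡ (^-homo-* x (length c) (nonRtlMaxima r))) ⟩
      x ^ nonLtrMinima [] l * (x ^ length c * x ^ nonRtlMaxima r) ∎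

  B≈prodFrom : ∀ m → B (suc (suc m)) x ≈ prodFrom 2+ix 1 m
  B≈prodFrom m = begin
    ∑ wt (S1n n)                                     ≈⟨ ∑-↭ wt (S1n↭allGluings m) ⟩
    ∑ wt (allGluings n O)                            ≈⟨ ∑-concatMap wt (gluings n) (tripartitions O) ⟩
    ∑ (λ t → ∑ wt (gluings n t)) (tripartitions O)   ≈⟨ ∑-cong (tripartitions O) gluings-weight ⟩
    ∑ (blockWeight 0 0 0) (tripartitions O)          ≈⟨ ∑-tripartitions O 0 0 0 ⟩
    prodFrom 2+ix 1 (length O)                       ≈⟨ reflexive (cong (prodFrom 2+ix 1) (interior-length m)) ⟩
    prodFrom 2+ix 1 m                                ∎
    where
    n = suc (suc m)
    O = interior m
    wt : List ℕ → Carrier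
    wt w = x ^ mmp1010 w
    gluings-weight : ∀ {t} → t ∈ tripartitions O → ∑ wt (gluings n t) ≈ blockWeight 0 0 0 t
    gluings-weight {X , Y , Z} t∈
      with All-tripartition O (All.tabulate ∈-interior⁻) t∈ | tripartitions-sorted O (interior-decreasing m) t∈
    ... | X-int , Y-int , Z-int | X-dec , Z-inc = ∑-gluings X-int Y-int Z-int X-dec !Y Z-inc
      where open UniqueBlocks (∈-tripartitions⇒UniqueBlocks O (interior-unique m) t∈) using () renaming (!₂ to !Y)

  prodFrom≈egfRHS : ∀ m → prodFrom 2+ix 1 m ≈ egfRHS m x
  prodFrom≈egfRHS zero = refl
  prodFrom≈egfRHS (suc m) = trans (prodFrom-suc 2+ix 1 m) (*-congʳ (prodFrom≈egfRHS m))

  2+[2i-1]x : ℕ → Carrier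
  2+[2i-1]x i = two + ((2 *ℕ i) ∸ 1) × x

  2+[2k+1]x≈ : ∀ k → 2+ix (suc (2 *ℕ k)) ≈ 2+[2i-1]x (suc k)
  2+[2k+1]x≈ k = reflexive (cong (λ t → two + t × x) (≡.sym (cong (_∸ 1) (ℕ.*-suc 2 k))))

  2+[2k+2]x≈ : ∀ k → 2+ix (suc (suc (2 *ℕ k))) ≈ two * 1+ix (suc k)
  2+[2k+2]x≈ k = begin
    two + suc (suc (2 *ℕ k)) × x  ≈⟨ +-congˡ (trans (reflexive (cong (_× x) 2k+2≡)) (×-homo-+ x (suc k) (suc k))) ⟩
    (1# + 1#) + (y + y)           ≈⟨ solve 2 (λ o Y → (o :+ o) :+ (Y :+ Y) := (o :+ Y) :+ (o :+ Y)) refl 1# y ⟩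
    (1# + y) + (1# + y)           ≈⟨ sym (+-cong (*-identityˡ _) (*-identityˡ _)) ⟩
    1# * (1# + y) + 1# * (1# + y) ≈⟨ sym (distribʳ (1# + y) 1# 1#) ⟩
    (1# + 1#) * (1# + y)          ∎
    where
    y = suc k × x
    2k+2≡ : suc (suc (2 *ℕ k)) ≡ suc k +ℕ suc k
    2k+2≡ = cong suc (≡.trans (cong (λ t → suc (k +ℕ t)) (ℕ.+-identityʳ k)) (≡.sym (ℕ.+-suc k k)))

  egfRHS-even : ∀ k → egfRHS (2 *ℕ k) x ≈ evenRHS k x
  egfRHS-even zero = sym (trans (*-identityˡ _) (*-identityˡ _))
  egfRHS-even (suc k) = begin
    egfRHS (2 *ℕ suc k) x
      ≈⟨ reflexive (cong (λ t → egfRHS t x) (ℕ.*-suc 2 k)) ⟩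
    (egfRHS (2 *ℕ k) x * 2+ix (suc (2 *ℕ k))) * 2+ix (suc (suc (2 *ℕ k)))
      ≈⟨ *-cong (*-cong (egfRHS-even k) (2+[2k+1]x≈ k)) (2+[2k+2]x≈ k) ⟩
    (evenRHS k x * 2+[2i-1]x (suc k)) * (two * 1+ix (suc k))
      ≈⟨ solve 6 (λ t p q G tw F → ((t :* (p :* q)) :* G) :* (tw :* F) := (tw :* t) :* ((p :* F) :* (q :* G))) refl
           (two ^ k) (prod k 1+ix) (prod k 2+[2i-1]x) (2+[2i-1]x (suc k)) two (1+ix (suc k)) ⟩
    evenRHS (suc k) x ∎

  egfRHS-odd : ∀ k → egfRHS (suc (2 *ℕ k)) x ≈ oddRHS k x
  egfRHS-odd k = begin
    egfRHS (2 *ℕ k) x * 2+ix (suc (2 *ℕ k)) ≈⟨ *-cong (egfRHS-even k) (2+[2k+1]x≈ k) ⟩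
    evenRHS k x * 2+[2i-1]x (suc k)
      ≈⟨ solve 4 (λ t p q G → (t :* (p :* q)) :* G := t :* (p :* (q :* G))) refl (two ^ k) (prod k 1+ix) (prod k 2+[2i-1]x) (2+[2i-1]x (suc k)) ⟩
    oddRHS k x ∎

open import Data.Nat using (ℕ; suc; _∸_; _*_)
open import Data.Product using (_×_; _,_)
import Data.Nat.Properties as ℕ
open import Relation.Binary.PropositionalEquality using (_≡_; cong; trans)

mainTheorem14 : ∀ {c ℓ : Level} (R : CommutativeSemiring c ℓ) (x : CommutativeSemiring.Carrier R) →
    ((m : ℕ) → CommutativeSemiring._≈_ R (Poly.B R (suc (suc m)) x) (Poly.egfRHS R m x))
    × ((n : ℕ) → CommutativeSemiring._≈_ R (Poly.B R (2 * suc n) x) (Poly.evenRHS R n x))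
    × ((n : ℕ) → CommutativeSemiring._≈_ R (Poly.B R ((2 * suc (suc n)) ∸ 1) x) (Poly.oddRHS R n x))
mainTheorem14 R x = egf , even , odd
  where
  open CommutativeSemiring R using (_≈_; reflexive) renaming (trans to ≈-trans)
  open Weights R x
  B-cong : ∀ {n n′} → n ≡ n′ → Poly.B R n x ≈ Poly.B R n′ x
  B-cong n≡n′ = reflexive (cong (λ n → Poly.B R n x) n≡n′)
  egf : ∀ m → Poly.B R (suc (suc m)) x ≈ Poly.egfRHS R m x
  egf m = ≈-trans (B≈prodFrom m) (prodFrom≈egfRHS m)
  even : ∀ n → Poly.B R (2 * suc n) x ≈ Poly.evenRHS R n x
  even n = ≈-trans (B-cong (ℕ.*-suc 2 n)) (≈-trans (egf (2 * n)) (egfRHS-even n))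
  odd : ∀ n → Poly.B R ((2 * suc (suc n)) ∸ 1) x ≈ Poly.oddRHS R n x
  odd n = ≈-trans (B-cong (trans (cong (_∸ 1) (ℕ.*-suc 2 (suc n))) (cong suc (ℕ.*-suc 2 n))))
                  (≈-trans (egf (suc (2 * n))) (egfRHS-odd n))
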